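{- Let $d,h\ge 2$ be fixed. (i) If $T^h_d$ can be black pebbled with $p$ pebbles, then there are deterministic thrifty $k$-way branching programs with $O(k^p)$ states (as $k\to\infty$) solving $FT^h_d(k)$ and $BT^h_d(k)$. (ii) If $T^h_d$ can be fractionally pebbled with $p$ pebbles, then there are nondeterministic thrifty $k$-way branching programs with $O(k^p)$ states solving $BT^h_d(k)$.
   Context: $T^h_d$ is the balanced rooted $d$-ary tree with $h$ levels. An instance with parameter $k$ assigns to each internal node $i$ a function $f_i:[k]^d\to[k]$ (given by its $k^d$ values) and to each leaf an element of $[k]=\{1,\dots,k\}$; $v_i$ is the leaf label for a leaf and $v_i=f_i(v_{j_1},\dots,v_{j_d})$ for an internal node with children $j_1,\dots,j_d$. $FT^h_d(k)$: output the root value; $BT^h_d(k)$: decide whether the root value is $1$. The $k$-ary input variables are $f_i(x)$ (internal $i$, $x\in[k]^d$) and one per leaf. Branching programs: a nondeterministic $k$-way branching program computing $g:[k]^m\to R$ is a directed rooted multigraph of states, edges labelled by elements of $[k]$, nonfinal states labelled by variable indices, $|R|$ final sink states labelled by elements of $R$; on input $x$, edges labelled $x_j$ out of states labelled $j$ are activated; each computation (path of activated edges from the root) is infinite, ends in the final state labelled $g(x)$, or aborts, and at least one ends in a final state. Deterministic: every nonfinal state has exactly $k$ outedges labelled $1,\dots,k$. A deterministic program for these problems is thrifty if on every input every query to a variable $f_i(x)$ of an internal node has $x$ equal to the tuple of correct values of the children of $i$; a nondeterministic one is thrifty if this holds along every computation ending in a final state. Pebbling: a fractional configuration assigns to each node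 $i$ reals $b(i),w(i)\ge 0$ with $b(i)+w(i)\le1$; the number of pebbles is $\sum_i(b(i)+w(i))$. Moves: (i) decrease any $b(i)$; (ii) increase any $w(i)$; (iii) if all children of $i$ have $b+w=1$ (vacuous for leaves), set $w(i)=0$, increase $b(i)$, and simultaneously decrease black values of the children of $i$. A fractional pebbling with $p$ pebbles starts and ends with all values $0$, has the root with black value $1$ at some point, and never exceeds $p$ pebbles. A black pebbling is a fractional pebbling in which always $w(i)=0$ and $b(i)\in\{0,1\}$.
   Formalization: In (ii) the fractional pebbling values b(i), w(i) and the number of pebbles p are rational rather than real. -}

module Defs where

open import Data.Nat using (ℕ; zero; suc; _+_; _≤_; s≤s)
open import Data.Integer using (+_)
open import Data.Fin using (Fin; zero; suc)
open import Data.Vec using (Vec; tabulate)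
open import Data.Unit using (⊤; tt)
open import Data.Empty using (⊥)
open import Data.Sum using (_⊎_; inj₁; inj₂)
open import Data.Product using (Σ; _×_; _,_; ∃; proj₁; proj₂)
open import Data.List using (List)
open import Data.List.Membership.Propositional using (_∈_)
open import Data.Rational as ℚ using (ℚ; 0ℚ; 1ℚ)
open import Relation.Nullary using (¬_)
open import Relation.Binary.PropositionalEquality using (_≡_)

-- A node of a tree with (suc h) levels is either its root (inj₁ tt) or
-- a node of the subtree (with h levels) below the j-th child of the root.

Node : ℕ → ℕ → Set
Node d zero    = ⊥
Node d (suc h) = ⊤ ⊎ (Fin d × Node d h)

root : ∀ {d h} → Node d (suc h)
root = inj₁ tt

IsRoot : ∀ {d h} → Node d h → Set
IsRoot {d} {suc h} (inj₁ _) = ⊤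
IsRoot {d} {suc h} (inj₂ _) = ⊥

Positive : ℕ → Set
Positive zero    = ⊥
Positive (suc _) = ⊤

IsInternal : ∀ {d h} → Node d h → Set
IsInternal {d} {suc h} (inj₁ _)       = Positive h
IsInternal {d} {suc h} (inj₂ (_ , x)) = IsInternal x

IsLeaf : ∀ {d h} → Node d h → Set
IsLeaf i = ¬ IsInternal i

child : ∀ {d h} (i : Node d h) → IsInternal i → Fin d → Node d h
child {d} {suc (suc h)} (inj₁ _) _ j = inj₂ (j , inj₁ tt)
child {d} {suc h} (inj₂ (a , x)) p j = inj₂ (a , child x p j)

IsChild : ∀ {d h} → Node d h → Node d h → Set
IsChild {d} c i = Σ (IsInternal i) λ p → Σ (Fin d) λ j → c ≡ child i p j

-- Instances of FT^h_d(k) / BT^h_d(k): the k-ary input variables.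
-- Elements of [k] = {1,…,k} are represented by Fin k, with the
-- element 1 represented by Fin.zero.

data Var (d h k : ℕ) : Set where
  fvar : (i : Node d h) → IsInternal i → Vec (Fin k) d → Var d h k
  lvar : (i : Node d h) → IsLeaf i → Var d h k

Input : ℕ → ℕ → ℕ → Set
Input d h k = Var d h k → Fin k

liftVar : ∀ {d h k} → Fin d → Var d h k → Var d (suc h) k
liftVar j (fvar x p v) = fvar (inj₂ (j , x)) p v
liftVar j (lvar x q)   = lvar (inj₂ (j , x)) q

mutual
  value : ∀ {d h k} → Input d h k → Node d h → Fin k
  value {d} {suc h} ρ (inj₁ _)       = rootValue h ρ
  value {d} {suc h} ρ (inj₂ (j , x)) = value (λ v → ρ (liftVar j v)) x

  rootValue : ∀ {d k} h → Input d (suc h) k → Fin k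
  rootValue zero    ρ = ρ (lvar (inj₁ tt) (λ ()))
  rootValue {d} (suc h) ρ =
    ρ (fvar (inj₁ tt) tt (tabulate λ j → value (λ v → ρ (liftVar j v)) (inj₁ tt)))

childTuple : ∀ {d h k} → Input d h k → (i : Node d h) → IsInternal i → Vec (Fin k) d
childTuple ρ i p = tabulate λ j → value ρ (child i p j)

NonEmpty : ℕ → Set
NonEmpty zero    = ⊥
NonEmpty (suc _) = ⊤

rootOf : ∀ {d h} → NonEmpty h → Node d h
rootOf {d} {suc h} _ = inj₁ tt

FT : ∀ d h k → NonEmpty h → Input d h k → Fin k
FT d h k ne ρ = value ρ (rootOf ne)

-- BT^h_d(k): decide whether the root value is 1.
-- Output Fin 2: zero = "yes, root value is 1", suc zero = "no".
isOne : ∀ {k} → Fin k → Fin 2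
isOne zero    = zero
isOne (suc _) = suc zero

BT : ∀ d h k → NonEmpty h → Input d h k → Fin 2
BT d h k ne ρ = isOne (value ρ (rootOf ne))

ThriftyQuery : ∀ {d h k} → Input d h k → Var d h k → Set
ThriftyQuery ρ (fvar i p x) = x ≡ childTuple ρ i p
ThriftyQuery ρ (lvar _ _)   = ⊤

-- k-way branching programs over variable set V with outputs Fin r.
-- States: m nonfinal states (Fin m) and the r final states (one per
-- output value), so the number of states is m + r.

record DetBP (V : Set) (k r : ℕ) : Set where
  field
    m     : ℕ
    start : Fin m ⊎ Fin r
    query : Fin m → V
    next  : Fin m → Fin k → Fin m ⊎ Fin r

  size : ℕ
  size = m + r

  step : (V → Fin k) → Fin m ⊎ Fin r → Fin m ⊎ Fin r
  step x (inj₁ s) = next s (x (query s))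
  step x (inj₂ o) = inj₂ o

  run : (V → Fin k) → ℕ → Fin m ⊎ Fin r
  run x zero    = start
  run x (suc t) = step x (run x t)

  Computes : ((V → Fin k) → Fin r) → Set
  Computes g = ∀ x → Σ ℕ λ t → run x t ≡ inj₂ (g x)

record NondetBP (V : Set) (k r : ℕ) : Set where
  field
    m     : ℕ
    start : Fin m ⊎ Fin r
    query : Fin m → V
    -- targets of the edges labelled a leaving nonfinal state s
    -- (a list, so parallel edges are allowed)
    edges : Fin m → Fin k → List (Fin m ⊎ Fin r)

  size : ℕ
  size = m + r

  data Path (x : V → Fin k) : Fin m ⊎ Fin r → Fin m ⊎ Fin r → Set where
    stop : ∀ {s} → Path x s s
    edge : ∀ (s : Fin m) {t u} → t ∈ edges s (x (query s)) → Path x t u → Path x (inj₁ s) u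

  AllQueries : ∀ {x s u} → (V → Set) → Path x s u → Set
  AllQueries P stop           = ⊤
  AllQueries P (edge s _ π)   = P (query s) × AllQueries P π

  Computes : ((V → Fin k) → Fin r) → Set
  Computes g = ∀ x → (Σ (Fin r) λ o → Path x start (inj₂ o))
                   × (∀ o → Path x start (inj₂ o) → o ≡ g x)

DetThrifty : ∀ {d h k r} → DetBP (Var d h k) k r → Set
DetThrifty {d} {h} {k} B = ∀ (ρ : Input d h k) t s → run ρ t ≡ inj₁ s → ThriftyQuery ρ (query s)
  where open DetBP B

NondetThrifty : ∀ {d h k r} → NondetBP (Var d h k) k r → Set
NondetThrifty {d} {h} {k} B = ∀ (ρ : Input d h k) o (π : Path ρ start (inj₂ o)) → AllQueries (ThriftyQuery ρ) π
  where open NondetBP B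

sumFin : ∀ n → (Fin n → ℚ) → ℚ
sumFin zero    f = 0ℚ
sumFin (suc n) f = f zero ℚ.+ sumFin n (λ j → f (suc j))

sumNodes : ∀ {d h} → (Node d h → ℚ) → ℚ
sumNodes {d} {zero}  f = 0ℚ
sumNodes {d} {suc h} f = f (inj₁ tt) ℚ.+ sumFin d (λ j → sumNodes (λ x → f (inj₂ (j , x))))

record Config (d h : ℕ) : Set where
  field
    b : Node d h → ℚ
    w : Node d h → ℚ
open Config public

ValidConfig : ∀ {d h} → Config d h → Set
ValidConfig C = ∀ i → (0ℚ ℚ.≤ b C i) × (0ℚ ℚ.≤ w C i) × (b C i ℚ.+ w C i ℚ.≤ 1ℚ)

pebbles : ∀ {d h} → Config d h → ℚ
pebbles C = sumNodes (λ i → b C i ℚ.+ w C i)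

EmptyConfig : ∀ {d h} → Config d h → Set
EmptyConfig C = ∀ i → (b C i ≡ 0ℚ) × (w C i ≡ 0ℚ)

data Move {d h} (C C' : Config d h) : Set where
  decB : (i : Node d h) → b C' i ℚ.≤ b C i
       → (∀ j → ¬ j ≡ i → b C' j ≡ b C j) → (∀ j → w C' j ≡ w C j) → Move C C'
  incW : (i : Node d h) → w C i ℚ.≤ w C' i
       → (∀ j → ¬ j ≡ i → w C' j ≡ w C j) → (∀ j → b C' j ≡ b C j) → Move C C'
  place : (i : Node d h)
       → (∀ c → IsChild c i → b C c ℚ.+ w C c ≡ 1ℚ)
       → w C' i ≡ 0ℚ → b C i ℚ.≤ b C' i
       → (∀ c → IsChild c i → b C' c ℚ.≤ b C c)
       → (∀ j → ¬ j ≡ i → ¬ IsChild j i → b C' j ≡ b C j)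
       → (∀ j → ¬ j ≡ i → w C' j ≡ w C j)
       → Move C C'

record FracPebbling (d h : ℕ) (p : ℚ) : Set where
  field
    len   : ℕ
    conf  : ℕ → Config d h
    valid : ∀ t → t ≤ len → ValidConfig (conf t)
    bound : ∀ t → t ≤ len → pebbles (conf t) ℚ.≤ p
    moves : ∀ t → suc t ≤ len → Move (conf t) (conf (suc t))
    first : EmptyConfig (conf zero)
    last  : EmptyConfig (conf len)
    rootBlack : Σ ℕ λ t → (t ≤ len) × Σ (Node d h) λ i → IsRoot i × (b (conf t) i ≡ 1ℚ)

open FracPebbling public

IsBlack : ∀ {d h p} → FracPebbling d h p → Set
IsBlack P = ∀ t → t ≤ len P → ∀ i →
  (w (conf P t) i ≡ 0ℚ) × ((b (conf P t) i ≡ 0ℚ) ⊎ (b (conf P t) i ≡ 1ℚ))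

BlackPebblable : ℕ → ℕ → ℕ → Set
BlackPebblable d h p = Σ (FracPebbling d h (+ p ℚ./ 1)) IsBlack

FracPebblable : ℕ → ℕ → ℚ → Set
FracPebblable d h p = FracPebbling d h p

2≤⇒NonEmpty : ∀ {h} → 2 ≤ h → NonEmpty h
2≤⇒NonEmpty (s≤s _) = tt

-- Scaling by a common denominator q, a fractional pebbling becomes one in which every node carries
-- some number of black and white units out of q.  Write each value in [k] with q digits in a base m
-- with k ≤ m^q ≤ 2^q k.  The branching program replays the pebbling: at time t its state stores, for
-- every node, one digit of the node's value per unit of pebble on it, the leading digits for black
-- units and the trailing ones for white units.  Black digits are computed, white digits are guessed and
-- verified when the node is black-pebbled.  When a black pebble is placed on i, the values of all
-- children of i are stored in full, so the program can make the thrifty query f_i(v_{j_1},…,v_{j_d}).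
-- A state stores at most p q digits, so there are O(m^{pq}) = O(k^p) states; a black pebbling has no
-- white units, nothing is guessed, and the program is deterministic.

module Submission where

open import Defs
open import Data.Bool using (Bool; true; false; T)
open import Data.Empty using (⊥-elim)
open import Data.Fin using (Fin; zero; suc; toℕ; combine; remQuot; splitAt; join; inject≤; fromℕ<)
import Data.Fin.Properties as Finₚ
open import Data.Integer as ℤ using (+_; ∣_∣)
open import Data.Integer.GCD using (gcd; gcd-zeroʳ)
import Data.Integer.Properties as ℤP
import Data.Integer.Solver
open import Data.List using (List; []; _∷_; [_]; map; length; allFin)
open import Data.List.Membership.Propositional using (_∈_)
open import Data.List.Membership.Propositional.Properties using (∈-map⁺; ∈-map⁻; ∈-allFin)
open import Data.List.Properties using (length-map)
open import Data.List.Relation.Unary.Any using (here)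
open import Data.Nat using (ℕ; zero; suc; _+_; _∸_; _*_; _^_; _≤_; _<_; z≤n; s≤s; _<?_; _≤ᵇ_; _<ᵇ_; NonZero; >-nonZero)
open import Data.Nat.DivMod using (_/_; m/n*n≡m; m/n*n≤m; m*n/n≡m; /-monoˡ-≤)
open import Data.Nat.Divisibility using (_∣_; ∣-refl; ∣-trans; ∣m⇒∣m*n; ∣n⇒∣m*n)
open import Data.Nat.Properties
open import Algebra.Properties.CommutativeSemigroup *-commutativeSemigroup using (x∙yz≈y∙xz)
import Data.Nat.Solver
open import Data.Product using (Σ; _×_; _,_; proj₁; proj₂)
open import Data.Rational as ℚ using (ℚ; ↥_; ↧_; ↧ₙ_; 0ℚ; 1ℚ)
open import Data.Rational.Literals using (fromℤ)
import Data.Rational.Properties as ℚP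
import Data.Rational.Unnormalised as ℚᵘ
import Data.Rational.Unnormalised.Properties as ℚᵘP
open import Data.Sum using (_⊎_; inj₁; inj₂)
open import Data.Unit using (⊤; tt)
open import Data.Vec using (Vec; []; _∷_; tabulate; replicate)
open import Data.Vec.Properties using (tabulate-cong)
open import Function using (_$_)
open import Relation.Binary.PropositionalEquality hiding ([_])
open import Relation.Nullary using (¬_; Dec; yes; no)

-- Finite types encoded in Fin

record FinEnc (A : Set) : Set where
  field
    size          : ℕ
    encode        : A → Fin size
    decode        : Fin size → A
    decode-encode : ∀ x → decode (encode x) ≡ x
open FinEnc

elements : ∀ {A} → FinEnc A → List A
elements E = map (decode E) (allFin (size E))

∈-elements : ∀ {A} (E : FinEnc A) x → x ∈ elements E
∈-elements E x = subst (_∈ elements E) (decode-encode E x) (∈-map⁺ (decode E) (∈-allFin (encode E x)))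

encFin : ∀ n → FinEnc (Fin n)
encFin n = record { size = n ; encode = λ x → x ; decode = λ x → x ; decode-encode = λ _ → refl }

enc⊤ : FinEnc ⊤
enc⊤ = record { size = 1 ; encode = λ _ → zero ; decode = λ _ → tt ; decode-encode = λ _ → refl }

enc× : ∀ {A B} → FinEnc A → FinEnc B → FinEnc (A × B)
enc× {A} {B} EA EB = record
  { size          = size EA * size EB
  ; encode        = λ (a , b) → combine (encode EA a) (encode EB b)
  ; decode        = λ i → decode₂ (remQuot (size EB) i)
  ; decode-encode = λ (a , b) → trans
      (cong decode₂ (Finₚ.remQuot-combine (encode EA a) (encode EB b)))
      (cong₂ _,_ (decode-encode EA a) (decode-encode EB b))
  }
  where
  decode₂ : Fin (size EA) × Fin (size EB) → A × B
  decode₂ (x , y) = decode EA x , decode EB y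

enc⊎ : ∀ {A B} → FinEnc A → FinEnc B → FinEnc (A ⊎ B)
enc⊎ {A} {B} EA EB = record
  { size          = size EA + size EB
  ; encode        = λ x → join (size EA) (size EB) (encode₂ x)
  ; decode        = λ i → decode₂ (splitAt (size EA) i)
  ; decode-encode = λ x → trans (cong decode₂ (Finₚ.splitAt-join (size EA) (size EB) (encode₂ x))) (inverse x)
  }
  where
  encode₂ : A ⊎ B → Fin (size EA) ⊎ Fin (size EB)
  encode₂ (inj₁ a) = inj₁ (encode EA a)
  encode₂ (inj₂ b) = inj₂ (encode EB b)
  decode₂ : Fin (size EA) ⊎ Fin (size EB) → A ⊎ B
  decode₂ (inj₁ a) = inj₁ (decode EA a)
  decode₂ (inj₂ b) = inj₂ (decode EB b)
  inverse : ∀ x → decode₂ (encode₂ x) ≡ x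
  inverse (inj₁ a) = cong inj₁ (decode-encode EA a)
  inverse (inj₂ b) = cong inj₂ (decode-encode EB b)

encVec : ∀ {A} → FinEnc A → ∀ n → FinEnc (Vec A n)
encVec EA zero = record
  { size = 1 ; encode = λ _ → zero ; decode = λ _ → [] ; decode-encode = λ { [] → refl } }
encVec EA (suc n) = record
  { size          = size E
  ; encode        = λ { (x ∷ xs) → encode E (x , xs) }
  ; decode        = λ i → proj₁ (decode E i) ∷ proj₂ (decode E i)
  ; decode-encode = λ { (x ∷ xs) → cong (λ (y , ys) → y ∷ ys) (decode-encode E (x , xs)) }
  }
  where E = enc× EA (encVec EA n)

size-encVec : ∀ m n → size (encVec (encFin m) n) ≡ m ^ n
size-encVec m zero    = refl
size-encVec m (suc n) = cong (m *_) (size-encVec m n)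

Σ≤ : ℕ → (ℕ → Set) → Set
Σ≤ L F = Σ ℕ λ t → t ≤ L × F t

encΣ≤ : ∀ L {F : ℕ → Set} → (∀ t → FinEnc (F t)) → FinEnc (Σ≤ L F)
encΣ≤ zero E = record
  { size          = size (E 0)
  ; encode        = λ { (zero , z≤n , x) → encode (E 0) x }
  ; decode        = λ i → 0 , z≤n , decode (E 0) i
  ; decode-encode = λ { (zero , z≤n , x) → cong (λ y → 0 , z≤n , y) (decode-encode (E 0) x) }
  }
encΣ≤ (suc L) {F} E = record
  { size          = size E′
  ; encode        = λ x → encode E′ (split x)
  ; decode        = λ i → unsplit (decode E′ i)
  ; decode-encode = λ x → trans (cong unsplit (decode-encode E′ (split x))) (unsplit-split x)
  }
  where
  E′ = enc⊎ (E 0) (encΣ≤ L (λ t → E (suc t)))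
  split : Σ≤ (suc L) F → F 0 ⊎ Σ≤ L (λ t → F (suc t))
  split (zero  , _     , x) = inj₁ x
  split (suc t , s≤s l , x) = inj₂ (t , l , x)
  unsplit : F 0 ⊎ Σ≤ L (λ t → F (suc t)) → Σ≤ (suc L) F
  unsplit (inj₁ x)           = 0 , z≤n , x
  unsplit (inj₂ (t , l , x)) = suc t , s≤s l , x
  unsplit-split : ∀ x → unsplit (split x) ≡ x
  unsplit-split (zero  , z≤n   , x) = refl
  unsplit-split (suc t , s≤s l , x) = refl

size-encΣ≤ : ∀ L {F : ℕ → Set} (E : ∀ t → FinEnc (F t)) M →
  (∀ t → t ≤ L → size (E t) ≤ M) → size (encΣ≤ L E) ≤ suc L * M
size-encΣ≤ zero    E M bnd = subst (size (E 0) ≤_) (sym (+-identityʳ M)) (bnd 0 z≤n)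
size-encΣ≤ (suc L) E M bnd =
  +-mono-≤ (bnd 0 z≤n) (size-encΣ≤ L (λ t → E (suc t)) M (λ t l → bnd (suc t) (s≤s l)))

_≟ₙ_ : ∀ {d h} (i j : Node d h) → Dec (i ≡ j)
_≟ₙ_ {h = suc h} (inj₁ tt)      (inj₁ tt)      = yes refl
_≟ₙ_ {h = suc h} (inj₁ tt)      (inj₂ _)       = no λ ()
_≟ₙ_ {h = suc h} (inj₂ _)       (inj₁ tt)      = no λ ()
_≟ₙ_ {h = suc h} (inj₂ (a , x)) (inj₂ (c , y)) with a Finₚ.≟ c | x ≟ₙ y
... | yes refl | yes refl = yes refl
... | no a≢c   | _        = no λ { refl → a≢c refl }
... | yes _    | no x≢y   = no λ { refl → x≢y refl }

internal? : ∀ {d h} (i : Node d h) → Dec (IsInternal i)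
internal? {h = suc zero}    (inj₁ tt)      = no λ ()
internal? {h = suc (suc h)} (inj₁ tt)      = yes tt
internal? {h = suc h}       (inj₂ (_ , x)) = internal? x

value-internal : ∀ {d h k} (ρ : Input d h k) i (p : IsInternal i) →
  value ρ i ≡ ρ (fvar i p (childTuple ρ i p))
value-internal {h = suc (suc h)} ρ (inj₁ tt)      p = refl
value-internal {h = suc (suc h)} ρ (inj₂ (j , x)) p = value-internal (λ v → ρ (liftVar j v)) x p

value-leaf : ∀ {d h k} (ρ : Input d h k) i (p : IsLeaf i) → value ρ i ≡ ρ (lvar i p)
value-leaf {h = suc zero}    ρ (inj₁ tt)      p = refl
value-leaf {h = suc (suc h)} ρ (inj₁ tt)      p = ⊥-elim (p tt)
value-leaf {h = suc h}       ρ (inj₂ (j , x)) p = value-leaf (λ v → ρ (liftVar j v)) x p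

height : ∀ {d h} → Node d h → ℕ
height {h = suc h} (inj₁ _)       = h
height {h = suc h} (inj₂ (_ , x)) = height x

height-child : ∀ {d h} (i : Node d h) p j → suc (height (child i p j)) ≡ height i
height-child {h = suc (suc h)} (inj₁ tt)      p j = refl
height-child {h = suc (suc h)} (inj₂ (a , x)) p j = height-child x p j

someLeaf : ∀ {d h} → Fin d → NonEmpty h → Σ (Node d h) IsLeaf
someLeaf {h = suc zero}    j _ = inj₁ tt , λ ()
someLeaf {h = suc (suc h)} j _ = let (x , x-leaf) = someLeaf {h = suc h} j tt in inj₂ (j , x) , x-leaf

isRoot⇒≡rootOf : ∀ {d h} (ne : NonEmpty h) (i : Node d h) → IsRoot i → i ≡ rootOf ne
isRoot⇒≡rootOf {h = suc h} ne (inj₁ tt) _ = refl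

FinΠ : ∀ n → (Fin n → Set) → Set
FinΠ zero    G = ⊤
FinΠ (suc n) G = G zero × FinΠ n (λ j → G (suc j))

lookupᶠ : ∀ {n G} → FinΠ n G → (j : Fin n) → G j
lookupᶠ (x , _)  zero    = x
lookupᶠ (_ , xs) (suc j) = lookupᶠ xs j

tabulateᶠ : ∀ {n G} → ((j : Fin n) → G j) → FinΠ n G
tabulateᶠ {zero}  g = tt
tabulateᶠ {suc n} g = g zero , tabulateᶠ (λ j → g (suc j))

lookupᶠ-tabulateᶠ : ∀ {n G} (g : (j : Fin n) → G j) j → lookupᶠ {n} {G} (tabulateᶠ g) j ≡ g j
lookupᶠ-tabulateᶠ g zero    = refl
lookupᶠ-tabulateᶠ g (suc j) = lookupᶠ-tabulateᶠ (λ j → g (suc j)) j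

NodeΠ : ∀ {d h} → (Node d h → Set) → Set
NodeΠ {d} {zero}  F = ⊤
NodeΠ {d} {suc h} F = F root × FinΠ d (λ j → NodeΠ {d} {h} (λ x → F (inj₂ (j , x))))

lookupₙ : ∀ {d h F} → NodeΠ {d} {h} F → (i : Node d h) → F i
lookupₙ {h = suc h} (x , _)  (inj₁ tt)      = x
lookupₙ {h = suc h} (_ , xs) (inj₂ (j , i)) = lookupₙ {h = h} (lookupᶠ xs j) i

tabulateₙ : ∀ {d h F} → ((i : Node d h) → F i) → NodeΠ {d} {h} F
tabulateₙ {h = zero}  g = tt
tabulateₙ {h = suc h} g = g root , tabulateᶠ (λ j → tabulateₙ {h = h} (λ x → g (inj₂ (j , x))))

lookupₙ-tabulateₙ : ∀ {d h F} (g : (i : Node d h) → F i) i → lookupₙ {F = F} (tabulateₙ g) i ≡ g i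
lookupₙ-tabulateₙ {h = suc h} g (inj₁ tt)      = refl
lookupₙ-tabulateₙ {h = suc h} g (inj₂ (j , x)) = trans
  (cong (λ xs → lookupₙ {h = h} xs x) (lookupᶠ-tabulateᶠ (λ j → tabulateₙ {h = h} (λ x → g (inj₂ (j , x)))) j))
  (lookupₙ-tabulateₙ {h = h} (λ x → g (inj₂ (j , x))) x)

sumFinℕ : ∀ n → (Fin n → ℕ) → ℕ
sumFinℕ zero    f = 0
sumFinℕ (suc n) f = f zero + sumFinℕ n (λ j → f (suc j))

sumNodesℕ : ∀ {d h} → (Node d h → ℕ) → ℕ
sumNodesℕ {h = zero}  c = 0
sumNodesℕ {h = suc h} c = c root + sumFinℕ _ (λ j → sumNodesℕ {h = h} (λ x → c (inj₂ (j , x))))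

encFinΠ : ∀ n {G} → ((j : Fin n) → FinEnc (G j)) → FinEnc (FinΠ n G)
encFinΠ zero    E = enc⊤
encFinΠ (suc n) E = enc× (E zero) (encFinΠ n (λ j → E (suc j)))

encNodeΠ : ∀ {d h F} → ((i : Node d h) → FinEnc (F i)) → FinEnc (NodeΠ {d} {h} F)
encNodeΠ {h = zero}  E = enc⊤
encNodeΠ {h = suc h} E = enc× (E root) (encFinΠ _ (λ j → encNodeΠ {h = h} (λ x → E (inj₂ (j , x)))))

size-encFinΠ : ∀ m n {G} (E : (j : Fin n) → FinEnc (G j)) (c : Fin n → ℕ) →
  (∀ j → size (E j) ≡ m ^ c j) → size (encFinΠ n E) ≡ m ^ sumFinℕ n c
size-encFinΠ m zero    E c e = refl
size-encFinΠ m (suc n) {G} E c e = trans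
  (cong₂ _*_ (e zero) (size-encFinΠ m n {λ j → G (suc j)} (λ j → E (suc j)) (λ j → c (suc j)) (λ j → e (suc j))))
  (sym (^-distribˡ-+-* m (c zero) _))

size-encNodeΠ : ∀ m {d h F} (E : (i : Node d h) → FinEnc (F i)) (c : Node d h → ℕ) →
  (∀ i → size (E i) ≡ m ^ c i) → size (encNodeΠ {F = F} E) ≡ m ^ sumNodesℕ c
size-encNodeΠ m {h = zero}  E c e = refl
size-encNodeΠ m {h = suc h} {F} E c e = trans
  (cong₂ _*_ (e root) (size-encFinΠ m _ _ (λ j → sumNodesℕ {h = h} (λ x → c (inj₂ (j , x))))
    (λ j → size-encNodeΠ m {h = h} {λ x → F (inj₂ (j , x))} (λ x → E (inj₂ (j , x))) (λ x → c (inj₂ (j , x))) (λ x → e (inj₂ (j , x))))))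
  (sym (^-distribˡ-+-* m (c root) _))

module _ {A : Set} where

  Prefix : ∀ {n} → Vec A n → (ℕ → A) → Set
  Prefix []       f = ⊤
  Prefix (x ∷ xs) f = x ≡ f 0 × Prefix xs (λ j → f (suc j))

  prefix? : (_≟_ : (x y : A) → Dec (x ≡ y)) → ∀ {n} (v : Vec A n) f → Dec (Prefix v f)
  prefix? _≟_ []       f = yes tt
  prefix? _≟_ (x ∷ xs) f with x ≟ f 0 | prefix? _≟_ xs (λ j → f (suc j))
  ... | yes x≡ | yes xs≺ = yes (x≡ , xs≺)
  ... | no x≢  | _       = no λ p → x≢ (proj₁ p)
  ... | yes _  | no xs⊀  = no λ p → xs⊀ (proj₂ p)

  prefix-[] : ∀ {n} (v : Vec A n) {f} → n ≡ 0 → Prefix v f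
  prefix-[] [] _ = tt

  take≤ : ∀ {a b} → a ≤ b → Vec A b → Vec A a
  take≤ z≤n     _        = []
  take≤ (s≤s p) (x ∷ xs) = x ∷ take≤ p xs

  prefix-take≤ : ∀ {a b} (p : a ≤ b) (v : Vec A b) {f} → Prefix v f → Prefix (take≤ p v) f
  prefix-take≤ z≤n     _        _         = tt
  prefix-take≤ (s≤s p) (x ∷ xs) (x≡ , xs≺) = x≡ , prefix-take≤ p xs xs≺

  prefix-take≤⁻ : ∀ {a b} (p : a ≤ b) (v : Vec A b) {f} → a ≡ b → Prefix (take≤ p v) f → Prefix v f
  prefix-take≤⁻ z≤n     []       _ _          = tt
  prefix-take≤⁻ (s≤s p) (x ∷ xs) e (x≡ , xs≺) = x≡ , prefix-take≤⁻ p xs (suc-injective e) xs≺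

  append≤ : ∀ {a b} → a ≤ b → Vec A a → Vec A (b ∸ a) → Vec A b
  append≤ z≤n     []       ys = ys
  append≤ (s≤s p) (x ∷ xs) ys = x ∷ append≤ p xs ys

  prefix-append≤ : ∀ {a b} (p : a ≤ b) (xs : Vec A a) ys {f} →
    Prefix xs f → Prefix ys (λ j → f (a + j)) → Prefix (append≤ p xs ys) f
  prefix-append≤ z≤n     []       ys _          ys≺ = ys≺
  prefix-append≤ (s≤s p) (x ∷ xs) ys (x≡ , xs≺) ys≺ = x≡ , prefix-append≤ p xs ys xs≺ ys≺

  prefix-append≤⁻ : ∀ {a b} (p : a ≤ b) (xs : Vec A a) ys {f} → Prefix (append≤ p xs ys) f → Prefix xs f
  prefix-append≤⁻ z≤n     []       ys _          = tt
  prefix-append≤⁻ (s≤s p) (x ∷ xs) ys (x≡ , xs≺) = x≡ , prefix-append≤⁻ p xs ys xs≺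

  takeStream : ∀ n → (ℕ → A) → Vec A n
  takeStream zero    f = []
  takeStream (suc n) f = f 0 ∷ takeStream n (λ j → f (suc j))

  prefix-takeStream : ∀ n f → Prefix (takeStream n f) f
  prefix-takeStream zero    f = tt
  prefix-takeStream (suc n) f = refl , prefix-takeStream n (λ j → f (suc j))

  lookupOr : ∀ {n} → A → Vec A n → ℕ → A
  lookupOr a []       j       = a
  lookupOr a (x ∷ xs) zero    = x
  lookupOr a (x ∷ xs) (suc j) = lookupOr a xs j

  lookupOr-prefix : ∀ {n} a (v : Vec A n) {f} → Prefix v f → ∀ j → j < n → lookupOr a v j ≡ f j
  lookupOr-prefix a (x ∷ xs) (x≡ , _)   zero    _       = x≡
  lookupOr-prefix a (x ∷ xs) (_  , xs≺) (suc j) (s≤s l) = lookupOr-prefix a xs xs≺ j l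

-- Branching programs over an abstract finite set of states

record AbstractNBP (V : Set) (k r : ℕ) : Set₁ where
  field
    State  : Set
    states : FinEnc State
    start  : State ⊎ Fin r
    query  : State → V
    edges  : State → Fin k → List (State ⊎ Fin r)

  data Path (x : V → Fin k) : State ⊎ Fin r → State ⊎ Fin r → Set where
    stop : ∀ {s} → Path x s s
    edge : ∀ s {t u} → t ∈ edges s (x (query s)) → Path x t u → Path x (inj₁ s) u

  AllQueries : ∀ {x s u} → (V → Set) → Path x s u → Set
  AllQueries P stop         = ⊤
  AllQueries P (edge s _ π) = P (query s) × AllQueries P π

  Accepting : (V → Fin k) → Fin r → Set
  Accepting x o = Path x start (inj₂ o)

  encodeState : State ⊎ Fin r → Fin (size states) ⊎ Fin r
  encodeState (inj₁ s) = inj₁ (encode states s)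
  encodeState (inj₂ o) = inj₂ o

  toNondetBP : NondetBP V k r
  toNondetBP = record
    { m     = size states
    ; start = encodeState start
    ; query = λ i → query (decode states i)
    ; edges = λ i a → map encodeState (edges (decode states i) a)
    }

  private module BP = NondetBP toNondetBP

  encodePath : ∀ {x s u} → Path x s u → BP.Path x (encodeState s) (encodeState u)
  encodePath stop = BP.stop
  encodePath {x} (edge s {t} t∈ π) = BP.edge (encode states s) t∈′ (encodePath π)
    where
    t∈′ : encodeState t ∈ map encodeState (edges (decode states (encode states s))
                                                  (x (query (decode states (encode states s)))))
    t∈′ rewrite decode-encode states s = ∈-map⁺ encodeState t∈

  decodePath : ∀ {x u o} (P : V → Set) (π : BP.Path x u (inj₂ o)) s → u ≡ encodeState s →
    Σ (Path x s (inj₂ o)) λ π′ → AllQueries P π′ → BP.AllQueries P π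
  decodePath P BP.stop (inj₂ o) refl = stop , λ _ → tt
  decodePath P (BP.edge _ t∈ π) (inj₁ s) refl
    with decode states (encode states s) | decode-encode states s
  ... | .s | refl with ∈-map⁻ encodeState t∈
  ... | t , t∈′ , refl with decodePath P π t refl
  ... | π′ , transfer = edge s t∈′ π′ , λ (q , qs) → q , transfer qs

  computes-toNondetBP : (g : (V → Fin k) → Fin r) →
    (∀ x → Σ (Fin r) (Accepting x)) → (∀ x o → Accepting x o → o ≡ g x) →
    NondetBP.Computes toNondetBP g
  computes-toNondetBP g accept correct x =
    (proj₁ (accept x) , encodePath (proj₂ (accept x))) ,
    λ o π → correct x o (proj₁ (decodePath (λ _ → ⊤) π start refl))

  allQueries-toNondetBP : (P : (V → Fin k) → V → Set) →
    (∀ x o (π : Accepting x o) → AllQueries (P x) π) →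
    ∀ x o (π : BP.Path x BP.start (inj₂ o)) → BP.AllQueries (P x) π
  allQueries-toNondetBP P all x o π =
    let (π′ , transfer) = decodePath (P x) π start refl in transfer (all x o π′)

  headOr : ∀ {A : Set} → A → List A → A
  headOr a []      = a
  headOr a (x ∷ _) = x

  module Deterministic (functional : ∀ s a → length (edges s a) ≤ 1) where

    toDetBP : DetBP V k r
    toDetBP = record
      { m     = size states
      ; start = encodeState start
      ; query = λ i → query (decode states i)
      ; next  = λ i a → headOr (encodeState start) (map encodeState (edges (decode states i) a))
      }

    open DetBP toDetBP using (run)

    headOr-singleton : ∀ {A : Set} (a t : A) l → length l ≤ 1 → t ∈ l → headOr a l ≡ t
    headOr-singleton a t (x ∷ [])    _         (here t≡x) = sym t≡x
    headOr-singleton a t (x ∷ y ∷ l) (s≤s ()) _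

    run-final : ∀ x n o → run x n ≡ inj₂ o → ∀ j → run x (n + j) ≡ inj₂ o
    run-final x n o e zero    rewrite +-identityʳ n = e
    run-final x n o e (suc j) rewrite +-suc n j | run-final x n o e j = refl

    run-follows : ∀ x (P : V → Set) {s o} (π : Path x s (inj₂ o)) n → run x n ≡ encodeState s →
      AllQueries P π →
      (Σ ℕ λ j → run x (n + j) ≡ inj₂ o) × (∀ j s′ → run x (n + j) ≡ inj₁ s′ → P (query (decode states s′)))
    run-follows x P stop n e _ =
      (0 , trans (cong (run x) (+-identityʳ n)) e) ,
      λ j s′ e′ → inj₁≢inj₂ (trans (sym e′) (run-final x n _ e j))
      where
      inj₁≢inj₂ : ∀ {A : Set} {s′ : Fin (size states)} {o : Fin r} → inj₁ s′ ≡ inj₂ o → A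
      inj₁≢inj₂ ()
    run-follows x P (edge s {t} t∈ π) n e (q , qs) =
      let ((j , reach) , later) = run-follows x P π (suc n) run-next qs
      in (suc j , trans (cong (run x) (+-suc n j)) reach) , queries later
      where
      run-next : run x (suc n) ≡ encodeState t
      run-next rewrite e | decode-encode states s =
        headOr-singleton _ _ _
          (subst (_≤ 1) (sym (length-map encodeState (edges s (x (query s))))) (functional s (x (query s))))
          (∈-map⁺ encodeState t∈)
      queries : (∀ j s′ → run x (suc n + j) ≡ inj₁ s′ → P (query (decode states s′))) →
        ∀ j s′ → run x (n + j) ≡ inj₁ s′ → P (query (decode states s′))
      queries later zero s′ e′ with trans (sym e′) (trans (cong (run x) (+-identityʳ n)) e)
      ... | refl rewrite decode-encode states s = q
      queries later (suc j) s′ e′ = later j s′ (trans (sym (cong (run x) (+-suc n j))) e′)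

    computes-toDetBP : (g : (V → Fin k) → Fin r) →
      (∀ x → Σ (Fin r) (Accepting x)) → (∀ x o → Accepting x o → o ≡ g x) →
      DetBP.Computes toDetBP g
    computes-toDetBP g accept correct x =
      let (o , π) = accept x
          ((j , reach) , _) = run-follows x (λ _ → ⊤) π 0 refl (trivial π)
      in j , trans reach (cong inj₂ (correct x o π))
      where
      trivial : ∀ {x s u} (π : Path x s u) → AllQueries (λ _ → ⊤) π
      trivial stop         = tt
      trivial (edge _ _ π) = tt , trivial π

    queries-toDetBP : (P : (V → Fin k) → V → Set) → (∀ x → Σ (Fin r) (Accepting x)) →
      (∀ x o (π : Accepting x o) → AllQueries (P x) π) →
      ∀ x t s → run x t ≡ inj₁ s → P x (query (decode states s))
    queries-toDetBP P accept all x t s e =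
      let (o , π) = accept x in proj₂ (run-follows x (P x) π 0 refl (all x o π)) t s e

-- Simulating a pebbling by a branching program

-- Pebble values are multiples of 1/q, and B t i, W t i count units of 1/q.  The pebbling may stop at
-- any time L after the target has been fully black at time t₀.
data ScaledMove {d h} (q : ℕ) (B W B′ W′ : Node d h → ℕ) : Set where
  dropBlack  : (∀ j → B′ j ≤ B j) → (∀ j → W′ j ≡ W j) → ScaledMove q B W B′ W′
  addWhite   : ∀ i → W i ≤ W′ i → (∀ j → ¬ j ≡ i → W′ j ≡ W j) → (∀ j → B′ j ≤ B j) →
               ScaledMove q B W B′ W′
  placeBlack : ∀ i → (∀ c → IsChild c i → B c + W c ≡ q) → W′ i ≡ 0 →
               (∀ j → ¬ j ≡ i → B′ j ≤ B j) → (∀ j → ¬ j ≡ i → W′ j ≡ W j) → ScaledMove q B W B′ W′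

record ScaledPebbling (d h q : ℕ) : Set where
  field
    L t₀    : ℕ
    t₀≤L    : t₀ ≤ L
    B W     : ℕ → Node d h → ℕ
    move    : ∀ t → t < L → ScaledMove q (B t) (W t) (B (suc t)) (W (suc t))
    B-start : ∀ i → B 0 i ≡ 0
    W-start : ∀ i → W 0 i ≡ 0
    W-end   : ∀ i → W L i ≡ 0
    target  : Node d h
    B-target : B t₀ target ≡ q

record DigitCode (k m q : ℕ) : Set where
  field
    digit          : Fin k → ℕ → Fin (suc m)
    undigit        : (ℕ → Fin (suc m)) → Fin k
    undigit-cong   : ∀ f g → (∀ j → j < q → f j ≡ g j) → undigit f ≡ undigit g
    undigit-digit  : ∀ v → undigit (digit v) ≡ v

SlotT : ℕ → Bool → Set
SlotT r true  = ⊤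
SlotT r false = Fin r

encSlot : ∀ r b → FinEnc (SlotT r b)
encSlot r true  = enc⊤
encSlot r false = encFin r

slot-size : ∀ r b → size (encSlot r b) ≤ suc r
slot-size r true  = s≤s z≤n
slot-size r false = n≤1+n r

slot-size-before : ∀ r b → T b → size (encSlot r b) ≤ 1
slot-size-before r true _ = ≤-refl

-- At time t the state holds, for each node i, the first B t i of the q digits of its value (black part)
-- and the last W t i digits in reverse order (white part).  White digits are guessed, and checked when
-- i is black-pebbled.  Steps that place no black pebble query the leaf ℓ and ignore the answer.
module Simulation {d h k m q : ℕ} (code : DigitCode k m q) (P : ScaledPebbling d h q)
  {r} (out : Fin k → Fin r) (ℓ : Node d h) (ℓ-leaf : IsLeaf ℓ) where

  open DigitCode code
  open ScaledPebbling P

  Digit : Set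
  Digit = Fin (suc m)

  Contents : ℕ → Node d h → Set
  Contents t i = Vec Digit (B t i) × Vec Digit (W t i)

  Memory : ℕ → Set
  Memory t = NodeΠ (Contents t)

  -- trivial up to t₀; afterwards it remembers the output, as the target may have lost its pebble
  Slot : ℕ → Set
  Slot t = SlotT r (t ≤ᵇ t₀)

  State : Set
  State = Σ≤ L (λ t → Memory t × Slot t)

  Step : ℕ → Set
  Step t = ScaledMove q (B t) (W t) (B (suc t)) (W (suc t))

  blacks : ∀ {t} → Memory t → (i : Node d h) → Vec Digit (B t i)
  blacks mem i = proj₁ (lookupₙ mem i)

  whites : ∀ {t} → Memory t → (i : Node d h) → Vec Digit (W t i)
  whites mem i = proj₂ (lookupₙ mem i)

  whiteDigit : Fin k → ℕ → Digit
  whiteDigit v j = digit v (q ∸ suc j)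

  merge : ∀ {β ω} → Vec Digit β → Vec Digit ω → ℕ → Digit
  merge {β} bs ws j with j <? β
  ... | yes _ = lookupOr zero bs j
  ... | no _  = lookupOr zero ws (q ∸ suc j)

  storedValue : ∀ {β ω} → Vec Digit β → Vec Digit ω → Fin k
  storedValue bs ws = undigit (merge bs ws)

  targetValue : ∀ {t} → Memory t → Fin k
  targetValue mem = undigit (lookupOr zero (blacks mem target))

  nextSlot : ∀ t → Memory t → Slot t → Slot (suc t)
  nextSlot t mem s with t <ᵇ t₀ | t ≤ᵇ t₀
  ... | true  | _     = tt
  ... | false | true  = out (targetValue mem)
  ... | false | false = s

  output : ∀ t → Memory t → Slot t → Fin r
  output t mem s with t ≤ᵇ t₀
  ... | true  = out (targetValue mem)
  ... | false = s

  stepQuery : ∀ t → Memory t → Step t → Var d h k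
  stepQuery t mem (placeBlack i _ _ _ _) with internal? i
  ... | yes i-int  = fvar i i-int (tabulate λ j → storedValue (blacks mem (child i i-int j)) (whites mem (child i i-int j)))
  ... | no  i-leaf = lvar i i-leaf
  stepQuery t mem _ = lvar ℓ ℓ-leaf

  query : State → Var d h k
  query (t , t≤L , mem , _) with m≤n⇒m<n∨m≡n t≤L
  ... | inj₁ t<L = stepQuery t mem (move t t<L)
  ... | inj₂ _   = lvar ℓ ℓ-leaf

  dropMemory : ∀ t → Memory t → (∀ j → B (suc t) j ≤ B t j) → (∀ j → W (suc t) j ≡ W t j) → Memory (suc t)
  dropMemory t mem B≤ W≡ = tabulateₙ λ j → take≤ (B≤ j) (blacks mem j) , take≤ (≤-reflexive (W≡ j)) (whites mem j)

  addWhites : ∀ t → Memory t → ∀ i → W t i ≤ W (suc t) i → (∀ j → ¬ j ≡ i → W (suc t) j ≡ W t j) →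
    Vec Digit (W (suc t) i ∸ W t i) → (j : Node d h) → Vec Digit (W (suc t) j)
  addWhites t mem i W≤ W≡ new j with j ≟ₙ i
  ... | yes refl = append≤ W≤ (whites mem i) new
  ... | no  j≢i  = take≤ (≤-reflexive (W≡ j j≢i)) (whites mem j)

  addWhiteMemory : ∀ t → Memory t → ∀ i → W t i ≤ W (suc t) i → (∀ j → ¬ j ≡ i → W (suc t) j ≡ W t j) →
    (∀ j → B (suc t) j ≤ B t j) → Vec Digit (W (suc t) i ∸ W t i) → Memory (suc t)
  addWhiteMemory t mem i W≤ W≡ B≤ new = tabulateₙ λ j → take≤ (B≤ j) (blacks mem j) , addWhites t mem i W≤ W≡ new j

  placeContents : ∀ t → Memory t → ∀ i → (∀ j → ¬ j ≡ i → B (suc t) j ≤ B t j) → (∀ j → ¬ j ≡ i → W (suc t) j ≡ W t j) →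
    Fin k → (j : Node d h) → Contents (suc t) j
  placeContents t mem i B≤ W≡ a j with j ≟ₙ i
  ... | yes refl = takeStream (B (suc t) i) (digit a) , replicate (W (suc t) i) zero
  ... | no  j≢i  = take≤ (B≤ j j≢i) (blacks mem j) , take≤ (≤-reflexive (W≡ j j≢i)) (whites mem j)

  placeMemory : ∀ t → Memory t → ∀ i → (∀ j → ¬ j ≡ i → B (suc t) j ≤ B t j) → (∀ j → ¬ j ≡ i → W (suc t) j ≡ W t j) →
    Fin k → Memory (suc t)
  placeMemory t mem i B≤ W≡ a = tabulateₙ (placeContents t mem i B≤ W≡ a)

  successor : ∀ t → t < L → Memory (suc t) → Slot t → Memory t → State ⊎ Fin r
  successor t t<L mem′ s mem = inj₁ (suc t , t<L , mem′ , nextSlot t mem s)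

  placeEdges : ∀ t → t < L → (mem : Memory t) → Slot t → ∀ i → (∀ j → ¬ j ≡ i → B (suc t) j ≤ B t j) →
    (∀ j → ¬ j ≡ i → W (suc t) j ≡ W t j) → (a : Fin k) → Dec (Prefix (whites mem i) (whiteDigit a)) →
    List (State ⊎ Fin r)
  placeEdges t t<L mem s i B≤ W≡ a (yes _) = [ successor t t<L (placeMemory t mem i B≤ W≡ a) s mem ]
  placeEdges t t<L mem s i B≤ W≡ a (no _)  = []

  stepEdges : ∀ t → t < L → Memory t → Slot t → Step t → Fin k → List (State ⊎ Fin r)
  stepEdges t t<L mem s (dropBlack B≤ W≡) a = [ successor t t<L (dropMemory t mem B≤ W≡) s mem ]
  stepEdges t t<L mem s (addWhite i W≤ W≡ B≤) a =
    map (λ new → successor t t<L (addWhiteMemory t mem i W≤ W≡ B≤ new) s mem)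
        (elements (encVec (encFin (suc m)) (W (suc t) i ∸ W t i)))
  stepEdges t t<L mem s (placeBlack i _ _ B≤ W≡) a =
    placeEdges t t<L mem s i B≤ W≡ a (prefix? Finₚ._≟_ (whites mem i) (whiteDigit a))

  edges : State → Fin k → List (State ⊎ Fin r)
  edges (t , t≤L , mem , s) a with m≤n⇒m<n∨m≡n t≤L
  ... | inj₁ t<L = stepEdges t t<L mem s (move t t<L) a
  ... | inj₂ _   = [ inj₂ (output t mem s) ]

  initial : State
  initial = 0 , z≤n , tabulateₙ (λ i → replicate (B 0 i) zero , replicate (W 0 i) zero) , tt

  encMemory : ∀ t → FinEnc (Memory t)
  encMemory t = encNodeΠ λ i → enc× (encVec (encFin (suc m)) (B t i)) (encVec (encFin (suc m)) (W t i))

  program : AbstractNBP (Var d h k) k r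
  program = record
    { State  = State
    ; states = encΣ≤ L (λ t → enc× (encMemory t) (encSlot r (t ≤ᵇ t₀)))
    ; start  = inj₁ initial
    ; query  = query
    ; edges  = edges
    }

  ∸-involutive : ∀ {j} → j < q → q ∸ suc (q ∸ suc j) ≡ j
  ∸-involutive (s≤s j≤) = m∸[m∸n]≡n j≤

  white-index : ∀ β ω j → β + ω ≡ q → ¬ j < β → j < q → q ∸ suc j < ω
  white-index β ω j β+ω≡q j≮β j<q = subst (q ∸ suc j <_) (trans (cong (_∸ β) (sym β+ω≡q)) (m+n∸m≡n β ω))
    (∸-monoʳ-< (s≤s (≮⇒≥ j≮β)) j<q)

  storedValue-correct : ∀ {β ω} (bs : Vec Digit β) (ws : Vec Digit ω) v → β + ω ≡ q →
    Prefix bs (digit v) → Prefix ws (whiteDigit v) → storedValue bs ws ≡ v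
  storedValue-correct {β} {ω} bs ws v β+ω≡q bs≺ ws≺ =
    trans (undigit-cong _ _ merge-correct) (undigit-digit v)
    where
    merge-correct : ∀ j → j < q → merge bs ws j ≡ digit v j
    merge-correct j j<q with j <? β
    ... | yes j<β = lookupOr-prefix zero bs bs≺ j j<β
    ... | no  j≮β = trans (lookupOr-prefix zero ws ws≺ (q ∸ suc j) (white-index β ω j β+ω≡q j≮β j<q))
                          (cong (digit v) (∸-involutive j<q))

  prefix-blacks : ∀ {t} (g : (j : Node d h) → Contents t j) i {f} →
    Prefix (proj₁ (g i)) f → Prefix (blacks (tabulateₙ g) i) f
  prefix-blacks g i = subst (λ c → Prefix (proj₁ c) _) (sym (lookupₙ-tabulateₙ g i))

  prefix-whites : ∀ {t} (g : (j : Node d h) → Contents t j) i {f} →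
    Prefix (proj₂ (g i)) f → Prefix (whites (tabulateₙ g) i) f
  prefix-whites g i = subst (λ c → Prefix (proj₂ c) _) (sym (lookupₙ-tabulateₙ g i))

  prefix-whites⁻ : ∀ {t} (g : (j : Node d h) → Contents t j) i {f} →
    Prefix (whites (tabulateₙ g) i) f → Prefix (proj₂ (g i)) f
  prefix-whites⁻ g i = subst (λ c → Prefix (proj₂ c) _) (lookupₙ-tabulateₙ g i)

  data Update t (mem : Memory t) : Step t → Fin k → Memory (suc t) → Set where
    dropped  : ∀ {B≤ W≡ a} → Update t mem (dropBlack B≤ W≡) a (dropMemory t mem B≤ W≡)
    whitened : ∀ {i W≤ W≡ B≤ a} new →
               Update t mem (addWhite i W≤ W≡ B≤) a (addWhiteMemory t mem i W≤ W≡ B≤ new)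
    placed   : ∀ {i full W≡0 B≤ W≡ a} → Prefix (whites mem i) (whiteDigit a) →
               Update t mem (placeBlack i full W≡0 B≤ W≡) a (placeMemory t mem i B≤ W≡ a)

  stepEdges-update : ∀ t t<L mem s M a {z} → z ∈ stepEdges t t<L mem s M a →
    Σ (Memory (suc t)) λ mem′ → Update t mem M a mem′ × z ≡ successor t t<L mem′ s mem
  stepEdges-update t t<L mem s (dropBlack _ _) a (here refl) = _ , dropped , refl
  stepEdges-update t t<L mem s (addWhite _ _ _ _) a z∈ with ∈-map⁻ _ z∈
  ... | new , _ , refl = _ , whitened new , refl
  stepEdges-update t t<L mem s (placeBlack i _ _ _ _) a z∈
    with prefix? Finₚ._≟_ (whites mem i) (whiteDigit a)
  stepEdges-update t t<L mem s (placeBlack i _ _ _ _) a (here refl) | yes ws≺ = _ , placed ws≺ , refl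

  update-stepEdges : ∀ t t<L mem s M a {mem′} → Update t mem M a mem′ →
    successor t t<L mem′ s mem ∈ stepEdges t t<L mem s M a
  update-stepEdges t t<L mem s _ a dropped = here refl
  update-stepEdges t t<L mem s (addWhite i _ _ _) a (whitened new) =
    ∈-map⁺ _ (∈-elements (encVec (encFin (suc m)) (W (suc t) i ∸ W t i)) new)
  update-stepEdges t t<L mem s (placeBlack i _ _ _ _) a (placed ws≺)
    with prefix? Finₚ._≟_ (whites mem i) (whiteDigit a)
  ... | yes _   = here refl
  ... | no  ws⊀ = ⊥-elim (ws⊀ ws≺)

  open AbstractNBP program using (Path; stop; edge; AllQueries; Accepting)

  module Run (ρ : Input d h k) where

    val : Node d h → Fin k
    val = value ρ

    BlackCorrect WhiteCorrect Correct ChildrenCorrect : ∀ {t} → Memory t → Node d h → Set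
    BlackCorrect    mem i = Prefix (blacks mem i) (digit (val i))
    WhiteCorrect    mem i = Prefix (whites mem i) (whiteDigit (val i))
    Correct         mem i = BlackCorrect mem i × WhiteCorrect mem i
    ChildrenCorrect mem i = ∀ c → IsChild c i → Correct mem c

    atState : (∀ {t} → Memory t → Node d h → Set) → State → Node d h → Set
    atState Q (_ , _ , mem , _) i = Q mem i

    stored-childTuple : ∀ {t} (mem : Memory t) i (i-int : IsInternal i) →
      (∀ c → IsChild c i → B t c + W t c ≡ q) → ChildrenCorrect mem i →
      tabulate (λ j → storedValue (blacks mem (child i i-int j)) (whites mem (child i i-int j))) ≡ childTuple ρ i i-int
    stored-childTuple mem i i-int full ok = tabulate-cong λ j →
      let cc = i-int , j , refl
      in storedValue-correct _ _ _ (full _ cc) (proj₁ (ok _ cc)) (proj₂ (ok _ cc))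

    placeQuery-answer : ∀ t (mem : Memory t) i full W≡0 B≤ W≡ → ChildrenCorrect mem i →
      ρ (stepQuery t mem (placeBlack i full W≡0 B≤ W≡)) ≡ val i
    placeQuery-answer t mem i full W≡0 B≤ W≡ ok with internal? i
    ... | yes i-int  = trans (cong (λ x → ρ (fvar i i-int x)) (stored-childTuple mem i i-int full ok))
                             (sym (value-internal ρ i i-int))
    ... | no  i-leaf = sym (value-leaf ρ i i-leaf)

    stepQuery-thrifty : ∀ t (mem : Memory t) M → (∀ i → Correct mem i) → ThriftyQuery ρ (stepQuery t mem M)
    stepQuery-thrifty t mem (dropBlack _ _)           ok = tt
    stepQuery-thrifty t mem (addWhite _ _ _ _)        ok = tt
    stepQuery-thrifty t mem (placeBlack i full _ _ _) ok with internal? i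
    ... | yes i-int = stored-childTuple mem i i-int full (λ c _ → ok c)
    ... | no  _     = tt

    query-thrifty : ∀ x → (∀ i → atState Correct x i) → ThriftyQuery ρ (query x)
    query-thrifty (t , t≤L , mem , _) ok with m≤n⇒m<n∨m≡n t≤L
    ... | inj₁ t<L = stepQuery-thrifty t mem (move t t<L) ok
    ... | inj₂ _   = tt

    data EdgeView : State → State ⊎ Fin r → Set where
      stepEdge : ∀ {t t≤L mem s} (t<L : t < L) {mem′} →
                 Update t mem (move t t<L) (ρ (stepQuery t mem (move t t<L))) mem′ →
                 EdgeView (t , t≤L , mem , s) (successor t t<L mem′ s mem)
      haltEdge : ∀ {t t≤L mem s} → t ≡ L → EdgeView (t , t≤L , mem , s) (inj₂ (output t mem s))

    edge-view : ∀ x {z} → z ∈ edges x (ρ (query x)) → EdgeView x z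
    edge-view (t , t≤L , mem , s) z∈ with m≤n⇒m<n∨m≡n t≤L
    ... | inj₁ t<L with stepEdges-update t t<L mem s (move t t<L) _ z∈
    ...   | _ , upd , refl = stepEdge t<L upd
    edge-view (t , t≤L , mem , s) (here refl) | inj₂ t≡L = haltEdge t≡L

    update-black : ∀ {t mem M mem′} i → Update t mem M (ρ (stepQuery t mem M)) mem′ →
      ChildrenCorrect mem i → BlackCorrect mem i → BlackCorrect mem′ i
    update-black {mem = mem} i (dropped {B≤ = B≤}) _ ok = prefix-blacks _ i (prefix-take≤ (B≤ i) (blacks mem i) ok)
    update-black {mem = mem} i (whitened {B≤ = B≤} _) _ ok = prefix-blacks _ i (prefix-take≤ (B≤ i) (blacks mem i) ok)
    update-black {t} {mem} i (placed {i′} {full} {W≡0} {B≤} {W≡} _) ch ok = prefix-blacks _ i placed-black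
      where
      placed-black : Prefix (proj₁ (placeContents t mem i′ B≤ W≡ (ρ (stepQuery t mem (placeBlack i′ full W≡0 B≤ W≡))) i))
                            (digit (val i))
      placed-black with i ≟ₙ i′
      ... | yes refl rewrite placeQuery-answer t mem i full W≡0 B≤ W≡ ch = prefix-takeStream _ _
      ... | no  i≢i′ = prefix-take≤ (B≤ i i≢i′) (blacks mem i) ok

    update-white : ∀ {t mem M mem′} i → Update t mem M (ρ (stepQuery t mem M)) mem′ →
      ChildrenCorrect mem i → WhiteCorrect mem′ i → WhiteCorrect mem i
    update-white {mem = mem} i (dropped {W≡ = W≡}) _ ok =
      prefix-take≤⁻ (≤-reflexive (W≡ i)) (whites mem i) (W≡ i) (prefix-whites⁻ _ i ok)
    update-white {t} {mem} i (whitened {i′} {W≤} {W≡} new) _ ok = old-whites (prefix-whites⁻ _ i ok)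
      where
      old-whites : Prefix (addWhites t mem i′ W≤ W≡ new i) (whiteDigit (val i)) → WhiteCorrect mem i
      old-whites ok′ with i ≟ₙ i′
      ... | yes refl = prefix-append≤⁻ W≤ (whites mem i) new ok′
      ... | no  i≢i′ = prefix-take≤⁻ (≤-reflexive (W≡ i i≢i′)) (whites mem i) (W≡ i i≢i′) ok′
    update-white {t} {mem} i (placed {i′} {full} {W≡0} {B≤} {W≡} checked) ch ok = old-whites (prefix-whites⁻ _ i ok)
      where
      old-whites : Prefix (proj₂ (placeContents t mem i′ B≤ W≡ (ρ (stepQuery t mem (placeBlack i′ full W≡0 B≤ W≡))) i))
                          (whiteDigit (val i)) → WhiteCorrect mem i
      old-whites ok′ with i ≟ₙ i′
      ... | yes refl rewrite placeQuery-answer t mem i full W≡0 B≤ W≡ ch = checked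
      ... | no  i≢i′ = prefix-take≤⁻ (≤-reflexive (W≡ i i≢i′)) (whites mem i) (W≡ i i≢i′) ok′

    edge-black : ∀ x y i → inj₁ y ∈ edges x (ρ (query x)) →
      atState ChildrenCorrect x i → atState BlackCorrect x i → atState BlackCorrect y i
    edge-black x y i e with edge-view x e
    ... | stepEdge _ upd = update-black i upd

    edge-white : ∀ x y i → inj₁ y ∈ edges x (ρ (query x)) →
      atState ChildrenCorrect x i → atState WhiteCorrect y i → atState WhiteCorrect x i
    edge-white x y i e with edge-view x e
    ... | stepEdge _ upd = update-white i upd

    halt-white : ∀ x {o} → inj₂ o ∈ edges x (ρ (query x)) → ∀ i → atState WhiteCorrect x i
    halt-white x e i with edge-view x e
    ... | haltEdge refl = prefix-[] _ (W-end i)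

    Everywhere : ∀ {s u} → (State → Set) → Path ρ s u → Set
    Everywhere Q stop         = ⊤
    Everywhere Q (edge x _ π) = Q x × Everywhere Q π

    everywhere-∀ : ∀ {s u} (π : Path ρ s u) {I : Set} (Q : I → State → Set) →
      (∀ a → Everywhere (Q a) π) → Everywhere (λ x → ∀ a → Q a x) π
    everywhere-∀ stop         Q all = tt
    everywhere-∀ (edge x _ π) Q all = (λ a → proj₁ (all a)) , everywhere-∀ π Q (λ a → proj₂ (all a))

    BlackCorrect⊎ : State ⊎ Fin r → Node d h → Set
    BlackCorrect⊎ (inj₁ x) i = atState BlackCorrect x i
    BlackCorrect⊎ (inj₂ _) i = ⊤

    -- black digits stay correct forward in time, white digits backward from the final state, which has none
    correct-along : ∀ i {s o} (π : Path ρ s (inj₂ o)) → Everywhere (λ x → atState ChildrenCorrect x i) π →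
      BlackCorrect⊎ s i → Everywhere (λ x → atState Correct x i) π
    correct-along i stop _ _ = tt
    correct-along i (edge x e stop) _ black = (black , halt-white x e i) , tt
    correct-along i (edge x e π@(edge y _ _)) (ch , chs) black =
      let rest = correct-along i π chs (edge-black x y i e ch black)
      in (black , edge-white x y i e ch (proj₂ (proj₁ rest))) , rest

    initial-black : ∀ i → atState BlackCorrect initial i
    initial-black i = prefix-blacks _ i (prefix-[] _ (B-start i))

    correct-by-height : ∀ {o} (π : Accepting ρ o) n i → height i < n → Everywhere (λ x → atState Correct x i) π
    correct-by-height π (suc n) i (s≤s h≤n) = correct-along i π children (initial-black i)
      where
      children : Everywhere (λ x → atState ChildrenCorrect x i) π
      children = everywhere-∀ π _ λ c → everywhere-∀ π _ λ { (i-int , j , refl) →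
        correct-by-height π n c (subst (_≤ n) (sym (height-child i i-int j)) h≤n) }

    correct-everywhere : ∀ {o} (π : Accepting ρ o) → Everywhere (λ x → ∀ i → atState Correct x i) π
    correct-everywhere π = everywhere-∀ π _ λ i → correct-by-height π (suc (height i)) i ≤-refl

    thrifty-along : ∀ {s u} (π : Path ρ s u) → Everywhere (λ x → ∀ i → atState Correct x i) π →
      AllQueries (ThriftyQuery ρ) π
    thrifty-along stop         _          = tt
    thrifty-along (edge x _ π) (ok , oks) = query-thrifty x ok , thrifty-along π oks

    SlotCorrect : ∀ b → SlotT r b → Set
    SlotCorrect true  _ = ⊤
    SlotCorrect false s = s ≡ out (val target)

    Settled : State ⊎ Fin r → Set
    Settled (inj₁ (t , _ , _ , s)) = SlotCorrect (t ≤ᵇ t₀) s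
    Settled (inj₂ o)               = o ≡ out (val target)

    targetValue-correct : ∀ t (mem : Memory t) → t ≡ t₀ → BlackCorrect mem target → targetValue mem ≡ val target
    targetValue-correct t mem refl ok = trans
      (undigit-cong _ _ λ j j<q → lookupOr-prefix zero (blacks mem target) ok j (subst (j <_) (sym B-target) j<q))
      (undigit-digit (val target))

    nextSlot-correct : ∀ t (mem : Memory t) s → SlotCorrect (t ≤ᵇ t₀) s → BlackCorrect mem target →
      SlotCorrect (suc t ≤ᵇ t₀) (nextSlot t mem s)
    nextSlot-correct t mem s s-ok ok with t <ᵇ t₀ in t<ᵇ | t ≤ᵇ t₀ in t≤ᵇ
    ... | true  | _     = tt
    ... | false | true  = cong out (targetValue-correct t mem t≡t₀ ok)
      where
      t≡t₀ : t ≡ t₀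
      t≡t₀ = ≤-antisym (≤ᵇ⇒≤ t t₀ (subst T (sym t≤ᵇ) tt)) (≮⇒≥ λ t<t₀ → subst T t<ᵇ (<⇒<ᵇ t<t₀))
    ... | false | false = s-ok

    output-correct : ∀ t (mem : Memory t) s → t ≡ L → SlotCorrect (t ≤ᵇ t₀) s → BlackCorrect mem target →
      output t mem s ≡ out (val target)
    output-correct t mem s t≡L s-ok ok with t ≤ᵇ t₀ in t≤ᵇ
    ... | true  = cong out (targetValue-correct t mem
                    (≤-antisym (≤ᵇ⇒≤ t t₀ (subst T (sym t≤ᵇ) tt)) (subst (t₀ ≤_) (sym t≡L) t₀≤L)) ok)
    ... | false = s-ok

    edge-settled : ∀ x {z} → z ∈ edges x (ρ (query x)) → Settled (inj₁ x) → atState BlackCorrect x target → Settled z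
    edge-settled x e settled ok with edge-view x e
    ... | stepEdge _ _ = nextSlot-correct _ _ _ settled ok
    ... | haltEdge t≡L = output-correct _ _ _ t≡L settled ok

    settled-along : ∀ {s o} (π : Path ρ s (inj₂ o)) → Everywhere (λ x → ∀ i → atState Correct x i) π →
      Settled s → o ≡ out (val target)
    settled-along stop         _          settled = settled
    settled-along (edge x e π) (ok , oks) settled =
      settled-along π oks (edge-settled x e settled (proj₁ (ok target)))

    accepting-output : ∀ o → Accepting ρ o → o ≡ out (val target)
    accepting-output o π = settled-along π (correct-everywhere π) tt

    accepting-thrifty : ∀ o (π : Accepting ρ o) → AllQueries (ThriftyQuery ρ) π
    accepting-thrifty o π = thrifty-along π (correct-everywhere π)

    honest-update : ∀ t (mem : Memory t) M → (∀ i → Correct mem i) →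
      Σ (Memory (suc t)) λ mem′ → Update t mem M (ρ (stepQuery t mem M)) mem′ × (∀ i → WhiteCorrect mem′ i)
    honest-update t mem (dropBlack B≤ W≡) ok =
      _ , dropped , λ i → prefix-whites _ i (prefix-take≤ (≤-reflexive (W≡ i)) (whites mem i) (proj₂ (ok i)))
    honest-update t mem (addWhite i′ W≤ W≡ B≤) ok = _ , whitened guess , λ i → prefix-whites _ i (new-whites i)
      where
      guess : Vec Digit (W (suc t) i′ ∸ W t i′)
      guess = takeStream _ (λ j → whiteDigit (val i′) (W t i′ + j))
      new-whites : ∀ i → Prefix (addWhites t mem i′ W≤ W≡ guess i) (whiteDigit (val i))
      new-whites i with i ≟ₙ i′
      ... | yes refl = prefix-append≤ W≤ (whites mem i) guess (proj₂ (ok i)) (prefix-takeStream _ _)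
      ... | no  i≢i′ = prefix-take≤ (≤-reflexive (W≡ i i≢i′)) (whites mem i) (proj₂ (ok i))
    honest-update t mem (placeBlack i′ full W≡0 B≤ W≡) ok = _ , placed checked , λ i → prefix-whites _ i (new-whites i)
      where
      answer : Fin k
      answer = ρ (stepQuery t mem (placeBlack i′ full W≡0 B≤ W≡))
      checked : Prefix (whites mem i′) (whiteDigit answer)
      checked rewrite placeQuery-answer t mem i′ full W≡0 B≤ W≡ (λ c _ → ok c) = proj₂ (ok i′)
      new-whites : ∀ i → Prefix (proj₂ (placeContents t mem i′ B≤ W≡ answer i)) (whiteDigit (val i))
      new-whites i with i ≟ₙ i′
      ... | yes refl = prefix-[] _ W≡0
      ... | no  i≢i′ = prefix-take≤ (≤-reflexive (W≡ i i≢i′)) (whites mem i) (proj₂ (ok i))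

    Honest : State → Set
    Honest x = (∀ i → atState Correct x i) × Settled (inj₁ x)

    HonestSuccessor : State → State ⊎ Fin r → Set
    HonestSuccessor x (inj₁ y) = Honest y × proj₁ y ≡ suc (proj₁ x)
    HonestSuccessor x (inj₂ _) = ⊤

    honest-edge : ∀ x → Honest x → Σ (State ⊎ Fin r) λ z → z ∈ edges x (ρ (query x)) × HonestSuccessor x z
    honest-edge (t , t≤L , mem , s) (ok , settled) with m≤n⇒m<n∨m≡n t≤L
    ... | inj₂ _   = _ , here refl , tt
    ... | inj₁ t<L with honest-update t mem (move t t<L) ok
    ...   | _ , upd , whites-ok =
      _ , update-stepEdges t t<L mem s _ _ upd ,
      ((λ i → update-black i upd (λ c _ → ok c) (proj₁ (ok i)) , whites-ok i) ,
       nextSlot-correct t mem s settled (proj₁ (ok target))) ,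
      refl

    honest-path : ∀ n x → n + proj₁ x ≡ L → Honest x → Σ (Fin r) λ o → Path ρ (inj₁ x) (inj₂ o)
    honest-path n x n+t≡L honest with honest-edge x honest
    ... | inj₂ o , e , _ = o , edge x e stop
    ... | inj₁ y , e , honest-y , y-time = continue n n+t≡L
      where
      continue : ∀ n → n + proj₁ x ≡ L → Σ (Fin r) λ o → Path ρ (inj₁ x) (inj₂ o)
      continue zero    t≡L = ⊥-elim (1+n≰n (subst (λ t → suc t ≤ L) t≡L (subst (_≤ L) y-time (proj₁ (proj₂ y)))))
      continue (suc n) n+t≡L′ =
        let (o , π) = honest-path n y (trans (cong (_+_ n) y-time) (trans (+-suc n _) n+t≡L′)) honest-y
        in o , edge x e π

    accepting-exists : Σ (Fin r) (Accepting ρ)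
    accepting-exists = honest-path L initial (+-identityʳ L)
      ((λ i → initial-black i , prefix-whites _ i (prefix-[] _ (W-start i))) , tt)

  open AbstractNBP program public using (states; toNondetBP)
  open AbstractNBP program using (computes-toNondetBP; allQueries-toNondetBP; module Deterministic)

  nondet-computes : NondetBP.Computes toNondetBP (λ ρ → out (value ρ target))
  nondet-computes = computes-toNondetBP _ Run.accepting-exists Run.accepting-output

  nondet-thrifty : NondetThrifty toNondetBP
  nondet-thrifty = allQueries-toNondetBP ThriftyQuery Run.accepting-thrifty

  size-states : ∀ N R → (∀ t → t ≤ L → sumNodesℕ (λ i → B t i + W t i) ≤ N) →
    (∀ t → t ≤ L → size (encSlot r (t ≤ᵇ t₀)) ≤ R) → size states ≤ suc L * (suc m ^ N * R)
  size-states N R pebbles≤ slot≤ = size-encΣ≤ L _ _ λ t t≤L →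
    *-mono-≤ (subst (_≤ suc m ^ N) (sym (size-encNodeΠ (suc m) _ (λ i → B t i + W t i) λ i →
                trans (cong₂ _*_ (size-encVec (suc m) (B t i)) (size-encVec (suc m) (W t i)))
                      (sym (^-distribˡ-+-* (suc m) (B t i) (W t i)))))
               (^-monoʳ-≤ (suc m) (pebbles≤ t t≤L)))
             (slot≤ t t≤L)

  -- without white pebbles no digit is ever guessed, so every state has at most one successor
  module Black (no-white : ∀ t → t ≤ L → ∀ i → W t i ≡ 0) where

    stepEdges-functional : ∀ t t<L mem s M a → length (stepEdges t t<L mem s M a) ≤ 1
    stepEdges-functional t t<L mem s (dropBlack _ _) a = ≤-refl
    stepEdges-functional t t<L mem s (addWhite i _ _ _) a =
      subst (_≤ 1) (sym (length-map _ (elements (encVec (encFin (suc m)) (W (suc t) i ∸ W t i)))))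
        (one-guess (W (suc t) i ∸ W t i) (cong₂ _∸_ (no-white (suc t) t<L i) (no-white t (<⇒≤ t<L) i)))
      where
      one-guess : ∀ n → n ≡ 0 → length (elements (encVec (encFin (suc m)) n)) ≤ 1
      one-guess zero _ = ≤-refl
    stepEdges-functional t t<L mem s (placeBlack i _ _ _ _) a with prefix? Finₚ._≟_ (whites mem i) (whiteDigit a)
    ... | yes _ = ≤-refl
    ... | no  _ = z≤n

    functional : ∀ x a → length (edges x a) ≤ 1
    functional (t , t≤L , mem , s) a with m≤n⇒m<n∨m≡n t≤L
    ... | inj₁ t<L = stepEdges-functional t t<L mem s (move t t<L) a
    ... | inj₂ _   = ≤-refl

    open Deterministic functional public using (toDetBP)
    open Deterministic functional using (computes-toDetBP; queries-toDetBP)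

    det-computes : DetBP.Computes toDetBP (λ ρ → out (value ρ target))
    det-computes = computes-toDetBP _ Run.accepting-exists Run.accepting-output

    det-thrifty : DetThrifty toDetBP
    det-thrifty = queries-toDetBP ThriftyQuery Run.accepting-exists Run.accepting-thrifty

^-distribʳ-* : ∀ a b n → (a * b) ^ n ≡ a ^ n * b ^ n
^-distribʳ-* a b zero    = refl
^-distribʳ-* a b (suc n) = begin
  a * b * (a * b) ^ n       ≡⟨ cong (a * b *_) (^-distribʳ-* a b n) ⟩
  a * b * (a ^ n * b ^ n)   ≡⟨ *-assoc a b _ ⟩
  a * (b * (a ^ n * b ^ n)) ≡⟨ cong (a *_) (x∙yz≈y∙xz b (a ^ n) (b ^ n)) ⟩
  a * (a ^ n * (b * b ^ n)) ≡⟨ *-assoc a (a ^ n) _ ⟨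
  a * a ^ n * (b * b ^ n)   ∎
  where open ≡-Reasoning

pow-bound : ∀ M q T k n → M ^ q ≤ T * k → M ^ (n * q) ≤ T ^ n * k ^ n
pow-bound M q T k n M^q≤ = begin
  M ^ (n * q)   ≡⟨ cong (M ^_) (*-comm n q) ⟩
  M ^ (q * n)   ≡⟨ ^-*-assoc M q n ⟨
  (M ^ q) ^ n   ≤⟨ ^-monoˡ-≤ n M^q≤ ⟩
  (T * k) ^ n   ≡⟨ ^-distribʳ-* T k n ⟩
  T ^ n * k ^ n ∎
  where open ≤-Reasoning

-- m ↦ (m + 1) ^ q grows by at most a factor 2 ^ q per step, so it cannot jump over [k, 2 ^ q k]
base-exists : ∀ q .{{_ : NonZero q}} k → 1 ≤ k → Σ ℕ λ m → k ≤ suc m ^ q × suc m ^ q ≤ 2 ^ q * k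
base-exists q (suc zero) _ = 0 , subst (1 ≤_) (sym (^-zeroˡ q)) ≤-refl ,
  subst (_≤ 2 ^ q * 1) (sym (^-zeroˡ q)) (subst (1 ≤_) (sym (*-identityʳ (2 ^ q))) (m^n>0 2 q))
base-exists q (suc (suc k)) _ with base-exists q (suc k) (s≤s z≤n)
... | m , k≤m^q , m^q≤2^qk with suc (suc k) ≤? suc m ^ q
...   | yes k+1≤m^q = m , k+1≤m^q , ≤-trans m^q≤2^qk (*-monoʳ-≤ (2 ^ q) (n≤1+n (suc k)))
...   | no  k+1≰m^q = suc m , k+1≤[m+1]^q , [m+1]^q≤2^q[k+1]
  where
  m^q≡k : suc m ^ q ≡ suc k
  m^q≡k = ≤-antisym (≤-pred (≰⇒> k+1≰m^q)) k≤m^q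
  k+1≤[m+1]^q : suc (suc k) ≤ suc (suc m) ^ q
  k+1≤[m+1]^q = subst (λ n → suc n ≤ suc (suc m) ^ q) m^q≡k (^-monoˡ-< q (≤-refl {suc (suc m)}))
  [m+1]^q≤2^q[k+1] : suc (suc m) ^ q ≤ 2 ^ q * suc (suc k)
  [m+1]^q≤2^q[k+1] = begin
    suc (suc m) ^ q    ≤⟨ ^-monoˡ-≤ q (subst (_≤ 2 * suc m) (+-comm (suc m) 1) (+-monoʳ-≤ (suc m) (m≤m+n 1 (m + 0)))) ⟩
    (2 * suc m) ^ q    ≡⟨ ^-distribʳ-* 2 (suc m) q ⟩
    2 ^ q * suc m ^ q  ≡⟨ cong (2 ^ q *_) m^q≡k ⟩
    2 ^ q * suc k      ≤⟨ *-monoʳ-≤ (2 ^ q) (n≤1+n (suc k)) ⟩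
    2 ^ q * suc (suc k) ∎
    where open ≤-Reasoning

module _ {m : ℕ} where

  toDigits : ∀ n → Fin (suc m ^ n) → Vec (Fin (suc m)) n
  toDigits zero    _ = []
  toDigits (suc n) x = let (a , x′) = remQuot (suc m ^ n) x in a ∷ toDigits n x′

  fromDigits : ∀ {n} → Vec (Fin (suc m)) n → Fin (suc m ^ n)
  fromDigits []       = zero
  fromDigits (a ∷ as) = combine a (fromDigits as)

  fromDigits-toDigits : ∀ n x → fromDigits (toDigits n x) ≡ x
  fromDigits-toDigits zero    zero = refl
  fromDigits-toDigits (suc n) x rewrite fromDigits-toDigits n (proj₂ (remQuot {suc m} (suc m ^ n) x)) =
    Finₚ.combine-remQuot (suc m ^ n) x

  tabulate-lookupOr : ∀ {n} (v : Vec (Fin (suc m)) n) → tabulate (λ i → lookupOr zero v (toℕ i)) ≡ v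
  tabulate-lookupOr []       = refl
  tabulate-lookupOr (x ∷ v) = cong (x ∷_) (tabulate-lookupOr v)

digitCode : ∀ m q k → suc k ≤ suc m ^ q → DigitCode (suc k) m q
digitCode m q k k<m^q = record
  { digit         = digit
  ; undigit       = undigit
  ; undigit-cong  = λ f g f≗g → cong (λ v → truncate (fromDigits {n = q} v)) (tabulate-cong λ i → f≗g (toℕ i) (Finₚ.toℕ<n i))
  ; undigit-digit = λ v → begin
      truncate (fromDigits {n = q} (tabulate (λ i → digit v (toℕ i)))) ≡⟨ cong (λ v → truncate (fromDigits {n = q} v)) (tabulate-lookupOr (toDigits q (inject≤ v k<m^q))) ⟩
      truncate (fromDigits (toDigits q (inject≤ v k<m^q)))     ≡⟨ cong truncate (fromDigits-toDigits q _) ⟩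
      truncate (inject≤ v k<m^q)                               ≡⟨ truncate-inject≤ v ⟩
      v                                                        ∎
  }
  where
  open ≡-Reasoning
  truncate : Fin (suc m ^ q) → Fin (suc k)
  truncate x with toℕ x <? suc k
  ... | yes x<k = fromℕ< x<k
  ... | no  _   = zero
  truncate-inject≤ : ∀ v → truncate (inject≤ v k<m^q) ≡ v
  truncate-inject≤ v with toℕ (inject≤ v k<m^q) <? suc k
  ... | yes x<k = Finₚ.toℕ-injective (trans (Finₚ.toℕ-fromℕ< x<k) (Finₚ.toℕ-inject≤ v k<m^q))
  ... | no  x≮k = ⊥-elim (x≮k (subst (_< suc k) (sym (Finₚ.toℕ-inject≤ v k<m^q)) (Finₚ.toℕ<n v)))
  digit : Fin (suc k) → ℕ → Fin (suc m)
  digit v = lookupOr zero (toDigits q (inject≤ v k<m^q))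
  undigit : (ℕ → Fin (suc m)) → Fin (suc k)
  undigit f = truncate (fromDigits {n = q} (tabulate (λ i → f (toℕ i))))

-- Scaling a fractional pebbling to whole units

fromℕ : ℕ → ℚ
fromℕ n = fromℤ (+ n)

fromℕ-+ : ∀ a b → fromℕ (a + b) ≡ fromℕ a ℚ.+ fromℕ b
fromℕ-+ a b = ℚP.toℚᵘ-injective (ℚᵘP.≃-sym (ℚᵘP.≃-trans (ℚP.toℚᵘ-homo-+ (fromℕ a) (fromℕ b)) (ℚᵘ.*≡* eq)))
  where
  open Data.Integer.Solver.+-*-Solver
  eq : (+ a ℤ.* + 1 ℤ.+ + b ℤ.* + 1) ℤ.* + 1 ≡ + (a + b) ℤ.* + 1
  eq rewrite ℤP.pos-+ a b = solve 2 (λ a b → (a :* con (+ 1) :+ b :* con (+ 1)) :* con (+ 1) := (a :+ b) :* con (+ 1)) refl (+ a) (+ b)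

fromℕ-* : ∀ a b → fromℕ (a * b) ≡ fromℕ a ℚ.* fromℕ b
fromℕ-* a b = ℚP.toℚᵘ-injective (ℚᵘP.≃-sym (ℚᵘP.≃-trans (ℚP.toℚᵘ-homo-* (fromℕ a) (fromℕ b))
  (ℚᵘ.*≡* (cong (ℤ._* + 1) (sym (ℤP.pos-* a b))))))

fromℕ-cancel-≤ : ∀ {a b} → fromℕ a ℚ.≤ fromℕ b → a ≤ b
fromℕ-cancel-≤ {a} {b} (ℚ.*≤* a≤b) = ℤP.drop‿+≤+ (subst₂ ℤ._≤_ (ℤP.*-identityʳ (+ a)) (ℤP.*-identityʳ (+ b)) a≤b)

fromℕ-injective : ∀ {a b} → fromℕ a ≡ fromℕ b → a ≡ b
fromℕ-injective e = ≤-antisym (fromℕ-cancel-≤ (ℚP.≤-reflexive e)) (fromℕ-cancel-≤ (ℚP.≤-reflexive (sym e)))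

+∣↥∣≡↥ : ∀ x → 0ℚ ℚ.≤ x → + ∣ ↥ x ∣ ≡ ↥ x
+∣↥∣≡↥ x (ℚ.*≤* 0≤x) = ℤP.0≤i⇒+∣i∣≡i (subst₂ ℤ._≤_ (ℤP.*-zeroˡ (↧ x)) (ℤP.*-identityʳ (↥ x)) 0≤x)

*-fromℕ-multiple-of-↧ : ∀ x c → 0ℚ ℚ.≤ x → x ℚ.* fromℕ (c * ↧ₙ x) ≡ fromℕ (∣ ↥ x ∣ * c)
*-fromℕ-multiple-of-↧ x@(ℚ.mkℚ n d-1 _) c 0≤x =
  ℚP.toℚᵘ-injective (ℚᵘP.≃-trans (ℚP.toℚᵘ-homo-* x (fromℕ (c * suc d-1))) (ℚᵘ.*≡* eq))
  where
  a = ∣ n ∣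
  eq : (n ℤ.* + (c * suc d-1)) ℤ.* + 1 ≡ + (a * c) ℤ.* + (suc d-1 * 1)
  eq = begin
    (n ℤ.* + (c * suc d-1)) ℤ.* + 1     ≡⟨ cong (λ z → (z ℤ.* + (c * suc d-1)) ℤ.* + 1) (+∣↥∣≡↥ x 0≤x) ⟨
    (+ a ℤ.* + (c * suc d-1)) ℤ.* + 1   ≡⟨ cong (ℤ._* + 1) (ℤP.pos-* a (c * suc d-1)) ⟨
    + (a * (c * suc d-1)) ℤ.* + 1       ≡⟨ ℤP.pos-* (a * (c * suc d-1)) 1 ⟨
    + (a * (c * suc d-1) * 1)           ≡⟨ cong +_ (solve 3 (λ a c d → (a :* (c :* d)) :* con 1 := (a :* c) :* (d :* con 1)) refl a c (suc d-1)) ⟩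
    + (a * c * (suc d-1 * 1))           ≡⟨ ℤP.pos-* (a * c) (suc d-1 * 1) ⟩
    + (a * c) ℤ.* + (suc d-1 * 1)       ∎
    where
    open ≡-Reasoning
    open Data.Nat.Solver.+-*-Solver

+/1≡fromℕ : ∀ p → + p ℚ./ 1 ≡ fromℕ p
+/1≡fromℕ p = ℚP.≃⇒≡ (ℚ.*≡* (trans (cong (ℤ._* + 1) ↥p/1) (cong (+ p ℤ.*_) (sym ↧p/1))))
  where
  gcd≡1 : gcd (+ p) (+ 1) ≡ + 1
  gcd≡1 = gcd-zeroʳ (+ p)
  ↥p/1 : ↥ (+ p ℚ./ 1) ≡ + p
  ↥p/1 = trans (sym (ℤP.*-identityʳ _)) (trans (cong (↥ (+ p ℚ./ 1) ℤ.*_) (sym gcd≡1)) (ℚP.↥-/ (+ p) 1))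
  ↧p/1 : ↧ (+ p ℚ./ 1) ≡ + 1
  ↧p/1 = trans (sym (ℤP.*-identityʳ _)) (trans (cong (↧ (+ p ℚ./ 1) ℤ.*_) (sym gcd≡1)) (ℚP.↧-/ (+ p) 1))

sumFinℕ-≥ : ∀ n (c : Fin n → ℕ) j → c j ≤ sumFinℕ n c
sumFinℕ-≥ (suc n) c zero    = m≤m+n _ _
sumFinℕ-≥ (suc n) c (suc j) = ≤-trans (sumFinℕ-≥ n (λ j → c (suc j)) j) (m≤n+m _ (c zero))

sumNodesℕ-≥ : ∀ {d h} (c : Node d h → ℕ) i → c i ≤ sumNodesℕ c
sumNodesℕ-≥ {h = suc h} c (inj₁ tt)      = m≤m+n _ _
sumNodesℕ-≥ {h = suc h} c (inj₂ (j , x)) = ≤-trans (sumNodesℕ-≥ {h = h} (λ x → c (inj₂ (j , x))) x)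
  (≤-trans (sumFinℕ-≥ _ (λ j → sumNodesℕ {h = h} (λ x → c (inj₂ (j , x)))) j) (m≤n+m _ (c root)))

fromℕ-sumFinℕ : ∀ n (f : Fin n → ℚ) (c : Fin n → ℕ) z → (∀ j → fromℕ (c j) ≡ f j ℚ.* z) →
  fromℕ (sumFinℕ n c) ≡ sumFin n f ℚ.* z
fromℕ-sumFinℕ zero    f c z e = sym (ℚP.*-zeroˡ z)
fromℕ-sumFinℕ (suc n) f c z e = begin
  fromℕ (c zero + sumFinℕ n _)                  ≡⟨ fromℕ-+ (c zero) _ ⟩
  fromℕ (c zero) ℚ.+ fromℕ (sumFinℕ n _)        ≡⟨ cong₂ ℚ._+_ (e zero) (fromℕ-sumFinℕ n _ _ z (λ j → e (suc j))) ⟩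
  f zero ℚ.* z ℚ.+ sumFin n (λ j → f (suc j)) ℚ.* z ≡⟨ ℚP.*-distribʳ-+ z (f zero) _ ⟨
  sumFin (suc n) f ℚ.* z                          ∎
  where open ≡-Reasoning

fromℕ-sumNodesℕ : ∀ {d h} (f : Node d h → ℚ) (c : Node d h → ℕ) z → (∀ i → fromℕ (c i) ≡ f i ℚ.* z) →
  fromℕ (sumNodesℕ c) ≡ sumNodes f ℚ.* z
fromℕ-sumNodesℕ {h = zero}  f c z e = sym (ℚP.*-zeroˡ z)
fromℕ-sumNodesℕ {d} {suc h} f c z e = begin
  fromℕ (c root + sumFinℕ d cs)           ≡⟨ fromℕ-+ (c root) _ ⟩
  fromℕ (c root) ℚ.+ fromℕ (sumFinℕ d cs) ≡⟨ cong₂ ℚ._+_ (e root) (fromℕ-sumFinℕ d fs cs z λ j →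
                                              fromℕ-sumNodesℕ {h = h} _ _ z (λ x → e (inj₂ (j , x)))) ⟩
  f root ℚ.* z ℚ.+ sumFin d fs ℚ.* z      ≡⟨ ℚP.*-distribʳ-+ z (f root) _ ⟨
  sumNodes f ℚ.* z                        ∎
  where
  open ≡-Reasoning
  cs : Fin d → ℕ
  cs j = sumNodesℕ {h = h} (λ x → c (inj₂ (j , x)))
  fs : Fin d → ℚ
  fs j = sumNodes {h = h} (λ x → f (inj₂ (j , x)))

sumFin-nonNeg : ∀ n (f : Fin n → ℚ) → (∀ j → 0ℚ ℚ.≤ f j) → 0ℚ ℚ.≤ sumFin n f
sumFin-nonNeg zero    f _ = ℚP.≤-refl
sumFin-nonNeg (suc n) f 0≤f = ℚP.+-mono-≤ (0≤f zero) (sumFin-nonNeg n (λ j → f (suc j)) (λ j → 0≤f (suc j)))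

sumNodes-nonNeg : ∀ {d h} (f : Node d h → ℚ) → (∀ i → 0ℚ ℚ.≤ f i) → 0ℚ ℚ.≤ sumNodes f
sumNodes-nonNeg {h = zero}  f _   = ℚP.≤-refl
sumNodes-nonNeg {h = suc h} f 0≤f = ℚP.+-mono-≤ (0≤f root)
  (sumFin-nonNeg _ _ λ j → sumNodes-nonNeg {h = h} _ (λ x → 0≤f (inj₂ (j , x))))

prodFinℕ : ∀ n → (Fin n → ℕ) → ℕ
prodFinℕ zero    f = 1
prodFinℕ (suc n) f = f zero * prodFinℕ n (λ j → f (suc j))

prodNodesℕ : ∀ {d h} → (Node d h → ℕ) → ℕ
prodNodesℕ {h = zero}  c = 1
prodNodesℕ {h = suc h} c = c root * prodFinℕ _ (λ j → prodNodesℕ {h = h} (λ x → c (inj₂ (j , x))))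

prodUpToℕ : ℕ → (ℕ → ℕ) → ℕ
prodUpToℕ zero    c = c 0
prodUpToℕ (suc n) c = prodUpToℕ n c * c (suc n)

∣-prodFinℕ : ∀ n (f : Fin n → ℕ) j → f j ∣ prodFinℕ n f
∣-prodFinℕ (suc n) f zero    = ∣m⇒∣m*n _ ∣-refl
∣-prodFinℕ (suc n) f (suc j) = ∣n⇒∣m*n (f zero) (∣-prodFinℕ n (λ j → f (suc j)) j)

∣-prodNodesℕ : ∀ {d h} (c : Node d h → ℕ) i → c i ∣ prodNodesℕ c
∣-prodNodesℕ {h = suc h} c (inj₁ tt)      = ∣m⇒∣m*n _ ∣-refl
∣-prodNodesℕ {h = suc h} c (inj₂ (j , x)) = ∣n⇒∣m*n (c root)
  (∣-trans (∣-prodNodesℕ {h = h} (λ x → c (inj₂ (j , x))) x) (∣-prodFinℕ _ _ j))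

∣-prodUpToℕ : ∀ n c t → t ≤ n → c t ∣ prodUpToℕ n c
∣-prodUpToℕ zero    c .zero z≤n = ∣-refl
∣-prodUpToℕ (suc n) c t t≤n with m≤n⇒m<n∨m≡n t≤n
... | inj₁ (s≤s t≤n′) = ∣m⇒∣m*n _ (∣-prodUpToℕ n c t t≤n′)
... | inj₂ refl       = ∣n⇒∣m*n (prodUpToℕ n c) ∣-refl

prodFinℕ-pos : ∀ n (f : Fin n → ℕ) → (∀ j → 1 ≤ f j) → 1 ≤ prodFinℕ n f
prodFinℕ-pos zero    f _   = s≤s z≤n
prodFinℕ-pos (suc n) f pos = *-mono-≤ (pos zero) (prodFinℕ-pos n _ (λ j → pos (suc j)))

prodNodesℕ-pos : ∀ {d h} (c : Node d h → ℕ) → (∀ i → 1 ≤ c i) → 1 ≤ prodNodesℕ c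
prodNodesℕ-pos {h = zero}  c _   = s≤s z≤n
prodNodesℕ-pos {h = suc h} c pos = *-mono-≤ (pos root)
  (prodFinℕ-pos _ _ λ j → prodNodesℕ-pos {h = h} _ (λ x → pos (inj₂ (j , x))))

prodUpToℕ-pos : ∀ n c → (∀ t → 1 ≤ c t) → 1 ≤ prodUpToℕ n c
prodUpToℕ-pos zero    c pos = pos 0
prodUpToℕ-pos (suc n) c pos = *-mono-≤ (prodUpToℕ-pos n c pos) (pos (suc n))

module Discretisation {d h} {p : ℚ} (P : FracPebbling d h p) where

  bv wv : ℕ → Node d h → ℚ
  bv t = b (conf P t)
  wv t = w (conf P t)

  q : ℕ
  q = prodUpToℕ (len P) λ t → prodNodesℕ λ i → ↧ₙ bv t i * ↧ₙ wv t i

  q≥1 : 1 ≤ q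
  q≥1 = prodUpToℕ-pos (len P) _ λ t → prodNodesℕ-pos _ λ i → *-mono-≤ {1} {↧ₙ bv t i} {1} {↧ₙ wv t i} (s≤s z≤n) (s≤s z≤n)

  instance
    q-nonZero : NonZero q
    q-nonZero = >-nonZero q≥1

  ∣q : ∀ {t} → t ≤ len P → ∀ {i n} → n ∣ ↧ₙ bv t i * ↧ₙ wv t i → n ∣ q
  ∣q {t} t≤len {i} n∣ = ∣-trans n∣ (∣-trans (∣-prodNodesℕ _ i) (∣-prodUpToℕ (len P) _ t t≤len))

  B W : ℕ → Node d h → ℕ
  B t i = ∣ ↥ bv t i ∣ * (q / ↧ₙ bv t i)
  W t i = ∣ ↥ wv t i ∣ * (q / ↧ₙ wv t i)

  record Scaled (a : ℕ) (x : ℚ) : Set where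
    constructor scaling
    field unscale : fromℕ a ≡ x ℚ.* fromℕ q
  open Scaled

  scaled : ∀ x → 0ℚ ℚ.≤ x → ↧ₙ x ∣ q → Scaled (∣ ↥ x ∣ * (q / ↧ₙ x)) x
  scaled x 0≤x ↧x∣q = scaling (sym (subst (λ n → x ℚ.* fromℕ n ≡ fromℕ (∣ ↥ x ∣ * (q / ↧ₙ x))) (m/n*n≡m ↧x∣q) (*-fromℕ-multiple-of-↧ x (q / ↧ₙ x) 0≤x)))

  scaled-B : ∀ t → t ≤ len P → ∀ i → Scaled (B t i) (bv t i)
  scaled-B t t≤len i = scaled (bv t i) (proj₁ (valid P t t≤len i)) (∣q t≤len (∣m⇒∣m*n _ ∣-refl))

  scaled-W : ∀ t → t ≤ len P → ∀ i → Scaled (W t i) (wv t i)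
  scaled-W t t≤len i = scaled (wv t i) (proj₁ (proj₂ (valid P t t≤len i))) (∣q t≤len (∣n⇒∣m*n (↧ₙ bv t i) ∣-refl))

  scaled-≤ : ∀ {a c x y} → Scaled a x → Scaled c y → x ℚ.≤ y → a ≤ c
  scaled-≤ (scaling a≈x) (scaling c≈y) x≤y = fromℕ-cancel-≤ (subst₂ ℚ._≤_ (sym a≈x) (sym c≈y) (ℚP.*-monoʳ-≤-nonNeg (fromℕ q) x≤y))

  scaled-≡ : ∀ {a c x y} → Scaled a x → Scaled c y → x ≡ y → a ≡ c
  scaled-≡ (scaling a≈x) (scaling c≈y) refl = fromℕ-injective (trans a≈x (sym c≈y))

  scaled-0 : ∀ {a x} → Scaled a x → x ≡ 0ℚ → a ≡ 0
  scaled-0 (scaling a≈x) refl = fromℕ-injective (trans a≈x (ℚP.*-zeroˡ (fromℕ q)))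

  scaled-1 : ∀ {a x} → Scaled a x → x ≡ 1ℚ → a ≡ q
  scaled-1 (scaling a≈x) refl = fromℕ-injective (trans a≈x (ℚP.*-identityˡ (fromℕ q)))

  scaled-+ : ∀ {a c x y} → Scaled a x → Scaled c y → Scaled (a + c) (x ℚ.+ y)
  scaled-+ {a} {c} {x} {y} (scaling a≈x) (scaling c≈y) = scaling $
    trans (fromℕ-+ a c) (trans (cong₂ ℚ._+_ a≈x c≈y) (sym (ℚP.*-distribʳ-+ (fromℕ q) x y)))

  scaledStep : ∀ t → suc t ≤ len P → Move (conf P t) (conf P (suc t)) →
    ScaledMove q (B t) (W t) (B (suc t)) (W (suc t))
  scaledStep t t+1≤len mv = translate mv
    where
    t≤len = ≤-trans (n≤1+n t) t+1≤len
    B-≤ : ∀ {j} → bv (suc t) j ℚ.≤ bv t j → B (suc t) j ≤ B t j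
    B-≤ {j} = scaled-≤ (scaled-B (suc t) t+1≤len j) (scaled-B t t≤len j)
    W-≡ : ∀ {j} → wv (suc t) j ≡ wv t j → W (suc t) j ≡ W t j
    W-≡ {j} = scaled-≡ (scaled-W (suc t) t+1≤len j) (scaled-W t t≤len j)
    translate : Move (conf P t) (conf P (suc t)) → ScaledMove q (B t) (W t) (B (suc t)) (W (suc t))
    translate (decB i b≤ b≡ w≡) = dropBlack B≤ (λ j → W-≡ (w≡ j))
      where
      B≤ : ∀ j → B (suc t) j ≤ B t j
      B≤ j with j ≟ₙ i
      ... | yes refl = B-≤ b≤
      ... | no  j≢i  = B-≤ (ℚP.≤-reflexive (b≡ j j≢i))
    translate (incW i w≤ w≡ b≡) =
      addWhite i (scaled-≤ (scaled-W t t≤len i) (scaled-W (suc t) t+1≤len i) w≤) (λ j j≢i → W-≡ (w≡ j j≢i))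
        (λ j → B-≤ (ℚP.≤-reflexive (b≡ j)))
    translate (place i full w≡0 _ b≤ b≡ w≡) =
      placeBlack i (λ c c-child → scaled-1 (scaled-+ (scaled-B t t≤len c) (scaled-W t t≤len c)) (full c c-child))
        (scaled-0 (scaled-W (suc t) t+1≤len i) w≡0) B≤ (λ j j≢i → W-≡ (w≡ j j≢i))
      where
      -- deciding ≤ on ℚ spares us deciding whether j is a child of i
      B≤ : ∀ j → ¬ j ≡ i → B (suc t) j ≤ B t j
      B≤ j j≢i with bv (suc t) j ℚP.≤? bv t j
      ... | yes ≤ = B-≤ ≤
      ... | no  ≰ = ⊥-elim (≰ (ℚP.≤-reflexive (b≡ j j≢i λ j-child → ≰ (b≤ j j-child))))

  scaledPebbling : (ne : NonEmpty h) → ∀ L t₀ → L ≤ len P → t₀ ≤ L →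
    bv t₀ (rootOf ne) ≡ 1ℚ → (∀ i → W L i ≡ 0) → ScaledPebbling d h q
  scaledPebbling ne L t₀ L≤len t₀≤L root-black W-end = record
    { L        = L
    ; t₀       = t₀
    ; t₀≤L     = t₀≤L
    ; B        = B
    ; W        = W
    ; move     = λ t t<L → scaledStep t (≤-trans t<L L≤len) (moves P t (≤-trans t<L L≤len))
    ; B-start  = λ i → scaled-0 (scaled-B 0 z≤n i) (proj₁ (first P i))
    ; W-start  = λ i → scaled-0 (scaled-W 0 z≤n i) (proj₂ (first P i))
    ; W-end    = W-end
    ; target   = rootOf ne
    ; B-target = scaled-1 (scaled-B t₀ (≤-trans t₀≤L L≤len) (rootOf ne)) root-black
    }

  0≤p : 0ℚ ℚ.≤ p
  0≤p = ℚP.≤-trans (sumNodes-nonNeg _ λ i → ℚP.+-mono-≤ (proj₁ (valid P 0 z≤n i)) (proj₁ (proj₂ (valid P 0 z≤n i))))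
                   (bound P 0 z≤n)

  pebbles-bound : ∀ t → t ≤ len P → sumNodesℕ (λ i → B t i + W t i) * ↧ₙ p ≤ ∣ ↥ p ∣ * q
  pebbles-bound t t≤len = fromℕ-cancel-≤ (begin
    fromℕ (S * ↧ₙ p)                                  ≡⟨ fromℕ-* S (↧ₙ p) ⟩
    fromℕ S ℚ.* fromℕ (↧ₙ p)                          ≡⟨ cong (ℚ._* fromℕ (↧ₙ p)) S≈ ⟩
    pebbles (conf P t) ℚ.* fromℕ q ℚ.* fromℕ (↧ₙ p)   ≤⟨ ℚP.*-monoʳ-≤-nonNeg (fromℕ (↧ₙ p))
                                                           (ℚP.*-monoʳ-≤-nonNeg (fromℕ q) (bound P t t≤len)) ⟩
    p ℚ.* fromℕ q ℚ.* fromℕ (↧ₙ p)                    ≡⟨ ℚP.*-assoc p (fromℕ q) _ ⟩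
    p ℚ.* (fromℕ q ℚ.* fromℕ (↧ₙ p))                  ≡⟨ cong (p ℚ.*_) (ℚP.*-comm (fromℕ q) (fromℕ (↧ₙ p))) ⟩
    p ℚ.* (fromℕ (↧ₙ p) ℚ.* fromℕ q)                  ≡⟨ ℚP.*-assoc p _ (fromℕ q) ⟨
    p ℚ.* fromℕ (↧ₙ p) ℚ.* fromℕ q                    ≡⟨ cong (ℚ._* fromℕ q) p↧≡∣↥∣ ⟩
    fromℕ ∣ ↥ p ∣ ℚ.* fromℕ q                         ≡⟨ fromℕ-* ∣ ↥ p ∣ q ⟨
    fromℕ (∣ ↥ p ∣ * q)                               ∎)
    where
    open ℚP.≤-Reasoning
    S = sumNodesℕ (λ i → B t i + W t i)
    S≈ : fromℕ S ≡ pebbles (conf P t) ℚ.* fromℕ q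
    S≈ = fromℕ-sumNodesℕ _ _ (fromℕ q) λ i → unscale $ scaled-+ (scaled-B t t≤len i) (scaled-W t t≤len i)
    p↧≡∣↥∣ : p ℚ.* fromℕ (↧ₙ p) ≡ fromℕ ∣ ↥ p ∣
    p↧≡∣↥∣ = subst₂ (λ a c → p ℚ.* fromℕ a ≡ fromℕ c) (*-identityˡ (↧ₙ p)) (*-identityʳ ∣ ↥ p ∣)
                    (*-fromℕ-multiple-of-↧ p 1 0≤p)

rootBlackTime : ∀ {d h p} (P : FracPebbling d h p) (ne : NonEmpty h) →
  Σ ℕ λ t₀ → t₀ ≤ len P × b (conf P t₀) (rootOf ne) ≡ 1ℚ
rootBlackTime P ne with rootBlack P
... | t₀ , t₀≤len , i , i-root , b≡1 = t₀ , t₀≤len , subst (λ j → b (conf P t₀) j ≡ 1ℚ) (isRoot⇒≡rootOf ne i i-root) b≡1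

black-pebbling⇒det-programs : ∀ {d h} (ne : NonEmpty h) → Σ (Node d h) IsLeaf → ∀ p → BlackPebblable d h p →
  ∀ {r : ℕ → ℕ} (out : ∀ {k} → Fin k → Fin (r k)) → (∀ k → 1 ≤ k → r k ≤ 2 * k) →
  Σ ℕ λ C → Σ ℕ λ k₀ → ∀ k → k₀ ≤ k →
    Σ (DetBP (Var d h k) k (r k)) λ B →
      DetBP.Computes B (λ ρ → out (value ρ (rootOf ne))) × DetThrifty B × DetBP.size B ≤ C * k ^ p
black-pebbling⇒det-programs {d} {h} ne (ℓ , ℓ-leaf) p (P , black) {r} out r≤2k =
  suc t₀ * (2 ^ q) ^ p + 2 , 1 , program
  where
  open Discretisation P
  t₀ = proj₁ (rootBlackTime P ne)
  t₀≤len = proj₁ (proj₂ (rootBlackTime P ne))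

  no-white : ∀ t → t ≤ len P → ∀ i → W t i ≡ 0
  no-white t t≤len i = scaled-0 (scaled-W t t≤len i) (proj₁ (black t t≤len i))

  SP : ScaledPebbling d h q
  SP = scaledPebbling ne t₀ t₀ t₀≤len ≤-refl (proj₂ (proj₂ (rootBlackTime P ne))) (no-white t₀ t₀≤len)

  pebbles≤ : ∀ t → t ≤ t₀ → sumNodesℕ (λ i → B t i + W t i) ≤ p * q
  pebbles≤ t t≤t₀ = subst (_≤ p * q) (*-identityʳ _)
    (subst (λ x → sumNodesℕ (λ i → B t i + W t i) * ↧ₙ x ≤ ∣ ↥ x ∣ * q) (+/1≡fromℕ p)
      (pebbles-bound t (≤-trans t≤t₀ t₀≤len)))

  1≤p : 1 ≤ p
  1≤p = positive p (begin
    q                                         ≡⟨ ScaledPebbling.B-target SP ⟨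
    B t₀ (rootOf ne)                          ≤⟨ m≤m+n _ _ ⟩
    B t₀ (rootOf ne) + W t₀ (rootOf ne)       ≤⟨ sumNodesℕ-≥ (λ i → B t₀ i + W t₀ i) (rootOf ne) ⟩
    sumNodesℕ (λ i → B t₀ i + W t₀ i)         ≤⟨ pebbles≤ t₀ ≤-refl ⟩
    p * q                                     ∎)
    where
    positive : ∀ n → q ≤ n * q → 1 ≤ n
    positive zero    q≤0 = ⊥-elim (<⇒≱ q≥1 q≤0)
    positive (suc _) _   = s≤s z≤n
    open ≤-Reasoning

  program : ∀ k → 1 ≤ k → Σ (DetBP (Var d h k) k (r k)) λ B →
    DetBP.Computes B (λ ρ → out (value ρ (rootOf ne))) × DetThrifty B × DetBP.size B ≤ (suc t₀ * (2 ^ q) ^ p + 2) * k ^ p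
  program (suc k) _ with base-exists q (suc k) (s≤s z≤n)
  ... | m , k≤m^q , m^q≤2^qk = toDetBP , det-computes , det-thrifty , size≤
    where
    open Simulation (digitCode m q k k≤m^q) SP out ℓ ℓ-leaf
    open Black (λ t t≤t₀ → no-white t (≤-trans t≤t₀ t₀≤len))
    K = suc k ^ p
    size≤ : size states + r (suc k) ≤ (suc t₀ * (2 ^ q) ^ p + 2) * K
    size≤ = begin
      size states + r (suc k)                       ≤⟨ +-mono-≤ (size-states (p * q) 1 pebbles≤ λ t t≤t₀ →
                                                         slot-size-before (r (suc k)) _ (≤⇒≤ᵇ t≤t₀))
                                                       (r≤2k (suc k) (s≤s z≤n)) ⟩
      suc t₀ * (suc m ^ (p * q) * 1) + 2 * suc k    ≤⟨ +-mono-≤ (*-monoʳ-≤ (suc t₀)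
                                                         (≤-trans (≤-reflexive (*-identityʳ _)) (pow-bound (suc m) q (2 ^ q) (suc k) p m^q≤2^qk)))
                                                       (*-monoʳ-≤ 2 (≤-trans (≤-reflexive (sym (*-identityʳ (suc k)))) (^-monoʳ-≤ (suc k) 1≤p))) ⟩
      suc t₀ * ((2 ^ q) ^ p * K) + 2 * K            ≡⟨ solve 3 (λ t c k → t :* (c :* k) :+ con 2 :* k := (t :* c :+ con 2) :* k)
                                                         refl (suc t₀) ((2 ^ q) ^ p) K ⟩
      (suc t₀ * (2 ^ q) ^ p + 2) * K                ∎
      where
      open ≤-Reasoning
      open Data.Nat.Solver.+-*-Solver

frac-pebbling⇒nondet-programs : ∀ {d h} (ne : NonEmpty h) → Σ (Node d h) IsLeaf → ∀ p → FracPebbling d h p →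
  ∀ {r} (out : ∀ {k} → Fin k → Fin r) →
  Σ ℕ λ C → Σ ℕ λ k₀ → ∀ k → k₀ ≤ k →
    Σ (NondetBP (Var d h k) k r) λ B →
      NondetBP.Computes B (λ ρ → out (value ρ (rootOf ne))) × NondetThrifty B × NondetBP.size B ^ ↧ₙ p ≤ C * k ^ ∣ ↥ p ∣
frac-pebbling⇒nondet-programs {d} {h} ne (ℓ , ℓ-leaf) p P {r} out = C₁ ^ den * (2 ^ q) ^ num , 1 , program
  where
  open Discretisation P
  den = ↧ₙ p
  num = ∣ ↥ p ∣
  N = num * q / den
  C₁ = suc (len P) * suc r + r

  SP : ScaledPebbling d h q
  SP = let (t₀ , t₀≤len , root-black) = rootBlackTime P ne
       in scaledPebbling ne (len P) t₀ ≤-refl t₀≤len root-black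
            (λ i → scaled-0 (scaled-W (len P) ≤-refl i) (proj₂ (last P i)))

  pebbles≤ : ∀ t → t ≤ len P → sumNodesℕ (λ i → B t i + W t i) ≤ N
  pebbles≤ t t≤len = subst (_≤ N) (m*n/n≡m _ den) (/-monoˡ-≤ den (pebbles-bound t t≤len))

  program : ∀ k → 1 ≤ k → Σ (NondetBP (Var d h k) k r) λ B →
    NondetBP.Computes B (λ ρ → out (value ρ (rootOf ne))) × NondetThrifty B ×
    NondetBP.size B ^ den ≤ C₁ ^ den * (2 ^ q) ^ num * k ^ num
  program (suc k) _ with base-exists q (suc k) (s≤s z≤n)
  ... | m , k≤m^q , m^q≤2^qk = toNondetBP , nondet-computes , nondet-thrifty , size≤
    where
    open Simulation (digitCode m q k k≤m^q) SP out ℓ ℓ-leaf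
    X = suc m ^ N
    size≤C₁X : size states + r ≤ C₁ * X
    size≤C₁X = begin
      size states + r                      ≤⟨ +-monoˡ-≤ r (size-states N (suc r) pebbles≤ (λ t _ → slot-size r (t ≤ᵇ ScaledPebbling.t₀ SP))) ⟩
      suc (len P) * (X * suc r) + r        ≤⟨ +-monoʳ-≤ (suc (len P) * (X * suc r)) (m≤m*n r X {{m^n≢0 (suc m) N}}) ⟩
      suc (len P) * (X * suc r) + r * X    ≡⟨ solve 4 (λ l x s r → l :* (x :* s) :+ r :* x := (l :* s :+ r) :* x)
                                                refl (suc (len P)) X (suc r) r ⟩
      C₁ * X                               ∎
      where
      open ≤-Reasoning
      open Data.Nat.Solver.+-*-Solver
    size≤ : (size states + r) ^ den ≤ C₁ ^ den * (2 ^ q) ^ num * suc k ^ num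
    size≤ = begin
      (size states + r) ^ den              ≤⟨ ^-monoˡ-≤ den size≤C₁X ⟩
      (C₁ * X) ^ den                       ≡⟨ ^-distribʳ-* C₁ X den ⟩
      C₁ ^ den * X ^ den                   ≡⟨ cong (C₁ ^ den *_) (^-*-assoc (suc m) N den) ⟩
      C₁ ^ den * suc m ^ (N * den)         ≤⟨ *-monoʳ-≤ (C₁ ^ den) (^-monoʳ-≤ (suc m) (m/n*n≤m (num * q) den)) ⟩
      C₁ ^ den * suc m ^ (num * q)         ≤⟨ *-monoʳ-≤ (C₁ ^ den) (pow-bound (suc m) q (2 ^ q) (suc k) num m^q≤2^qk) ⟩
      C₁ ^ den * ((2 ^ q) ^ num * suc k ^ num) ≡⟨ *-assoc (C₁ ^ den) _ _ ⟨
      C₁ ^ den * (2 ^ q) ^ num * suc k ^ num   ∎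
      where open ≤-Reasoning

theorem3p4 : ∀ (d h : ℕ) → 2 ≤ d → (hh : 2 ≤ h) →
    ((p : ℕ) → BlackPebblable d h p →
      (Σ ℕ λ C → Σ ℕ λ k₀ → ∀ k → k₀ ≤ k →
        Σ (DetBP (Var d h k) k k) λ B →
          DetBP.Computes B (FT d h k (2≤⇒NonEmpty hh)) × DetThrifty B
            × DetBP.size B ≤ C * k ^ p)
      × (Σ ℕ λ C → Σ ℕ λ k₀ → ∀ k → k₀ ≤ k →
        Σ (DetBP (Var d h k) k 2) λ B →
          DetBP.Computes B (BT d h k (2≤⇒NonEmpty hh)) × DetThrifty B
            × DetBP.size B ≤ C * k ^ p))
    × ((p : ℚ) → FracPebblable d h p →
      Σ ℕ λ C → Σ ℕ λ k₀ → ∀ k → k₀ ≤ k →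
        Σ (NondetBP (Var d h k) k 2) λ B →
          NondetBP.Computes B (BT d h k (2≤⇒NonEmpty hh)) × NondetThrifty B
            × NondetBP.size B ^ (↧ₙ p) ≤ C * k ^ ∣ ↥ p ∣)
theorem3p4 d h 2≤d 2≤h =
  (λ p pebbling →
    black-pebbling⇒det-programs ne leaf p pebbling (λ v → v) (λ k _ → m≤n*m k 2) ,
    black-pebbling⇒det-programs ne leaf p pebbling isOne (λ k 1≤k → *-monoʳ-≤ 2 1≤k)) ,
  (λ p pebbling → frac-pebbling⇒nondet-programs ne leaf p pebbling isOne)
  where
  ne = 2≤⇒NonEmpty 2≤h
  leaf = someLeaf (fromℕ< (≤-trans (s≤s z≤n) 2≤d)) ne
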